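{- Fix two positive integers $b$ and $k$. Then \[ \lim_{N\to\infty}\frac{\left|\{(r,s)\in\mathbb{N}\times\mathbb{N}: 0<r,s\le N,\ \gcd_b(r,s)=k\}\right|}{N^2}=\frac{1}{k^{b+1}\zeta(b+1)}, \] where $\zeta$ is the Riemann zeta function.
   Context: For $b\in\mathbb{N}=\{1,2,3,\dots\}$ and $r,s\in\mathbb{N}$, $\gcd_b(r,s)=\max\{k\in\mathbb{N}: k\mid r \text{ and } k^b\mid s\}$. -}

module Defs where

open import Data.Nat as ℕ using (ℕ; zero; suc; _^_; NonZero)
open import Data.Nat.Divisibility using (_∣?_)
open import Data.Nat.Properties using (m^n≢0; m*n≢0)
open import Data.Bool using (Bool; true; false; _∧_; if_then_else_)
open import Data.List using (List; map; filter; length; upTo)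
open import Data.Nat.ListAction using (sum)
open import Data.Integer using (+_)
open import Data.Rational as ℚ using (ℚ; 1ℚ; _+_; _*_; _/_; 1/_; Positive)
open import Data.Rational.Properties using (pos+pos⇒pos; pos⇒nonZero; normalize-pos)
open import Relation.Nullary.Decidable using (⌊_⌋)

-- gcd_b(r,s) = max { k ∈ ℕ, k ≥ 1 : k ∣ r and k^b ∣ s }.
-- Computed by searching k = r, r-1, ..., 1 (any such k satisfies k ≤ r
-- when r ≥ 1, and k = 1 always qualifies, so the search returns the max).
gcdSearch : ℕ → ℕ → ℕ → ℕ → ℕ
gcdSearch b r s zero    = zero
gcdSearch b r s (suc k) =
  if ⌊ suc k ∣? r ⌋ ∧ ⌊ suc k ^ b ∣? s ⌋ then suc k else gcdSearch b r s k

gcdB : ℕ → ℕ → ℕ → ℕ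
gcdB b r s = gcdSearch b r s r

range1 : ℕ → List ℕ
range1 N = map suc (upTo N)

count : ℕ → ℕ → ℕ → ℕ
count b k N = sum (map (λ r → length (filter (λ s → gcdB b r s ℕ.≟ k) (range1 N))) (range1 N))

density : ℕ → ℕ → (N : ℕ) → .{{NonZero N}} → ℚ
density b k N {{nz}} = ((+ count b k N) / (N ℕ.* N)) {{m*n≢0 N N}}

-- partial sums of ζ(b+1):  zetaPartial b M = Σ_{n=1}^{M+1} 1/n^(b+1)
zetaPartial : ℕ → ℕ → ℚ
zetaPartial b zero    = 1ℚ
zetaPartial b (suc M) = zetaPartial b M + ((+ 1) / (suc (suc M) ^ suc b)) {{m^n≢0 (suc (suc M)) (suc b)}}

zetaPartial-pos : ∀ b M → Positive (zetaPartial b M)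
zetaPartial-pos b zero = _
zetaPartial-pos b (suc M) =
  pos+pos⇒pos (zetaPartial b M) {{zetaPartial-pos b M}} _ {{pos-term}}
  where
  pos-term : Positive (((+ 1) / (suc (suc M) ^ suc b)) {{m^n≢0 (suc (suc M)) (suc b)}})
  pos-term = normalize-pos 1 (suc (suc M) ^ suc b) {{m^n≢0 (suc (suc M)) (suc b)}}

-- the target constant, approximated at stage M:
--   1 / (k^(b+1) · zetaPartial b M)   →   1 / (k^(b+1) ζ(b+1))  as M → ∞
target : ℕ → (k : ℕ) → .{{NonZero k}} → ℕ → ℚ
target b k M =
  ((1/ zetaPartial b M) {{pos⇒nonZero (zetaPartial b M) {{zetaPartial-pos b M}}}})
    * ((+ 1) / (k ^ suc b)) {{m^n≢0 k (suc b)}}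

module Submission where

-- Let C(R, S) count the pairs (r, s) ∈ [1, R] × [1, S] with gcd_b(r, s) = 1. Since
-- gcd_b(d r, d^b s) = d exactly when gcd_b(r, s) = 1, the pairs with gcd_b = d are counted by
-- C(⌊R/d⌋, ⌊S/d^b⌋), and partitioning the box by the value of gcd_b gives
--   R S = Σ_{d ≥ 1} C(⌊R/d⌋, ⌊S/d^b⌋).
-- Let c be the reciprocal of a partial sum of ζ(b+1). If |C(R,S) − c R S| ≤ δ R S for all large
-- R and S, then solving the identity for the d = 1 term gives the same bound with δ replaced by
-- (3/4) δ + 2/D: the scales 2 ≤ d ≤ D carry weight Σ d^-(b+1) ≤ 3/4, and the scales d > D
-- together with the rounding of ⌊R/d⌋ ⌊S/d^b⌋ contribute at most RS/D each. Iterating from the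
-- trivial bound δ = 1 drives the relative error to 0, without Möbius inversion. Finally the pairs
-- counted by the theorem are those of C(⌊N/k⌋, ⌊N/k^b⌋).

open import Defs

open import Algebra.Bundles using (CommutativeSemiring; CommutativeRing)
open import Data.Nat as ℕ using (ℕ; zero; suc; _^_; _∸_; NonZero; z≤n; s≤s)
import Data.Nat.Properties as ℕP
import Data.Rational.Properties as ℚP
open import Function using (_∘_)

module Summation {c ℓ} (R : CommutativeSemiring c ℓ) where

  open CommutativeSemiring R
  open import Relation.Binary.Reasoning.Setoid setoid

  ∑ : (ℕ → Carrier) → ℕ → Carrier
  ∑ f zero    = 0#
  ∑ f (suc n) = f 0 + ∑ (f ∘ suc) n

  syntax ∑ (λ i → e) n = ∑[ i < n ] e

  ∑-cong : ∀ {f g} n → (∀ i → i ℕ.< n → f i ≈ g i) → ∑ f n ≈ ∑ g n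
  ∑-cong zero    f≈g = refl
  ∑-cong (suc n) f≈g = +-cong (f≈g 0 (s≤s z≤n)) (∑-cong n (λ i i<n → f≈g (suc i) (s≤s i<n)))

  ∑-zero : ∀ n → ∑[ _ < n ] 0# ≈ 0#
  ∑-zero zero    = refl
  ∑-zero (suc n) = trans (+-identityˡ _) (∑-zero n)

  ∑-vanishing : ∀ {f} n → (∀ i → i ℕ.< n → f i ≈ 0#) → ∑ f n ≈ 0#
  ∑-vanishing n f≈0 = trans (∑-cong n f≈0) (∑-zero n)

  ∑-split : ∀ f m n → ∑ f (m ℕ.+ n) ≈ ∑ f m + ∑[ i < n ] f (m ℕ.+ i)
  ∑-split f zero    n = sym (+-identityˡ _)
  ∑-split f (suc m) n = begin
    f 0 + ∑ (f ∘ suc) (m ℕ.+ n)                         ≈⟨ +-congˡ (∑-split (f ∘ suc) m n) ⟩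
    f 0 + (∑ (f ∘ suc) m + ∑[ i < n ] f (suc m ℕ.+ i))  ≈⟨ sym (+-assoc _ _ _) ⟩
    f 0 + ∑ (f ∘ suc) m + ∑[ i < n ] f (suc m ℕ.+ i)    ∎

  ∑-snoc : ∀ f n → ∑ f (suc n) ≈ ∑ f n + f n
  ∑-snoc f zero    = trans (+-identityʳ _) (sym (+-identityˡ _))
  ∑-snoc f (suc n) = trans (+-congˡ (∑-snoc (f ∘ suc) n)) (sym (+-assoc _ _ _))

  ∑-distrib-+ : ∀ f g n → ∑[ i < n ] (f i + g i) ≈ ∑ f n + ∑ g n
  ∑-distrib-+ f g zero    = sym (+-identityˡ 0#)
  ∑-distrib-+ f g (suc n) = begin
    (f 0 + g 0) + ∑[ i < n ] (f (suc i) + g (suc i))  ≈⟨ +-congˡ (∑-distrib-+ (f ∘ suc) (g ∘ suc) n) ⟩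
    (f 0 + g 0) + (∑ (f ∘ suc) n + ∑ (g ∘ suc) n)     ≈⟨ +-assoc _ _ _ ⟩
    f 0 + (g 0 + (∑ (f ∘ suc) n + ∑ (g ∘ suc) n))     ≈⟨ +-congˡ (sym (+-assoc _ _ _)) ⟩
    f 0 + ((g 0 + ∑ (f ∘ suc) n) + ∑ (g ∘ suc) n)     ≈⟨ +-congˡ (+-congʳ (+-comm _ _)) ⟩
    f 0 + ((∑ (f ∘ suc) n + g 0) + ∑ (g ∘ suc) n)     ≈⟨ +-congˡ (+-assoc _ _ _) ⟩
    f 0 + (∑ (f ∘ suc) n + (g 0 + ∑ (g ∘ suc) n))     ≈⟨ sym (+-assoc _ _ _) ⟩
    (f 0 + ∑ (f ∘ suc) n) + (g 0 + ∑ (g ∘ suc) n)     ∎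

  ∑-comm : ∀ (h : ℕ → ℕ → Carrier) m n →
           ∑[ i < m ] ∑[ j < n ] h i j ≈ ∑[ j < n ] ∑[ i < m ] h i j
  ∑-comm h zero    n = sym (∑-zero n)
  ∑-comm h (suc m) n = begin
    ∑[ j < n ] h 0 j + ∑[ i < m ] ∑[ j < n ] h (suc i) j  ≈⟨ +-congˡ (∑-comm (h ∘ suc) m n) ⟩
    ∑[ j < n ] h 0 j + ∑[ j < n ] ∑[ i < m ] h (suc i) j  ≈⟨ sym (∑-distrib-+ _ _ n) ⟩
    ∑[ j < n ] (h 0 j + ∑[ i < m ] h (suc i) j)            ∎

  ∑-distribˡ-* : ∀ x f n → ∑[ i < n ] (x * f i) ≈ x * ∑ f n
  ∑-distribˡ-* x f zero    = sym (zeroʳ x)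
  ∑-distribˡ-* x f (suc n) = trans (+-congˡ (∑-distribˡ-* x (f ∘ suc) n)) (sym (distribˡ x _ _))

  ∑-distribʳ-* : ∀ x f n → ∑[ i < n ] (f i * x) ≈ ∑ f n * x
  ∑-distribʳ-* x f n = trans (∑-cong n (λ i _ → *-comm (f i) x)) (trans (∑-distribˡ-* x f n) (*-comm x _))


module Fractions where

  open import Data.Integer as ℤ using (+_)
  import Data.Integer.Properties as ℤP
  open import Data.Nat.Tactic.RingSolver using (solve-∀)
  open import Data.Rational as ℚ using (ℚ; _+_; _*_; _-_; -_; _/_; _≤_; _<_; 0ℚ; 1ℚ; ∣_∣; toℚᵘ)
  open import Data.Rational.Unnormalised as ℚᵘ using (mkℚᵘ; *≡*; *≤*; *<*)
  import Data.Rational.Unnormalised.Properties as ℚᵘP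
  open import Relation.Binary.PropositionalEquality
  open import Data.Rational.Solver using (module +-*-Solver)
  open import Data.Sum using (inj₁; inj₂)
  open +-*-Solver using (solve; _:=_; _:+_; _:-_; :-_)

  infixl 7 _÷_

  _÷_ : (a b : ℕ) → .{{NonZero b}} → ℚ
  a ÷ b = + a / b

  toℚ : ℕ → ℚ
  toℚ n = n ÷ 1

  toℚᵘ-÷ : ∀ a b .{{_ : NonZero b}} → toℚᵘ (a ÷ b) ℚᵘ.≃ (+ a ℚᵘ./ b)
  toℚᵘ-÷ a (suc b) = ℚP.toℚᵘ-fromℚᵘ (mkℚᵘ (+ a) b)

  ÷-cong : ∀ a b c d .{{_ : NonZero b}} .{{_ : NonZero d}} → a ℕ.* d ≡ c ℕ.* b → a ÷ b ≡ c ÷ d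
  ÷-cong a b@(suc _) c d@(suc _) ad≡cb = ℚP.toℚᵘ-injective (ℚᵘP.≃-trans (toℚᵘ-÷ a b)
    (ℚᵘP.≃-trans (*≡* (trans (sym (ℤP.pos-* a d)) (trans (cong +_ ad≡cb) (ℤP.pos-* c b))))
                 (ℚᵘP.≃-sym (toℚᵘ-÷ c d))))

  ÷-mono-≤ : ∀ a b c d .{{_ : NonZero b}} .{{_ : NonZero d}} → a ℕ.* d ℕ.≤ c ℕ.* b → a ÷ b ≤ c ÷ d
  ÷-mono-≤ a b@(suc _) c d@(suc _) ad≤cb = ℚP.toℚᵘ-cancel-≤
    (ℚᵘP.≤-respˡ-≃ (ℚᵘP.≃-sym (toℚᵘ-÷ a b)) (ℚᵘP.≤-respʳ-≃ (ℚᵘP.≃-sym (toℚᵘ-÷ c d))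
      (*≤* (subst₂ ℤ._≤_ (ℤP.pos-* a d) (ℤP.pos-* c b) (ℤ.+≤+ ad≤cb)))))

  ÷-mono-< : ∀ a b c d .{{_ : NonZero b}} .{{_ : NonZero d}} → a ℕ.* d ℕ.< c ℕ.* b → a ÷ b < c ÷ d
  ÷-mono-< a b@(suc _) c d@(suc _) ad<cb = ℚP.toℚᵘ-cancel-<
    (ℚᵘP.<-respˡ-≃ (ℚᵘP.≃-sym (toℚᵘ-÷ a b)) (ℚᵘP.<-respʳ-≃ (ℚᵘP.≃-sym (toℚᵘ-÷ c d))
      (*<* (subst₂ ℤ._<_ (ℤP.pos-* a d) (ℤP.pos-* c b) (ℤ.+<+ ad<cb)))))

  ÷-+ : ∀ a b c d .{{_ : NonZero b}} .{{_ : NonZero d}} →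
        a ÷ b + c ÷ d ≡ ((a ℕ.* d ℕ.+ c ℕ.* b) ÷ (b ℕ.* d)) {{ℕP.m*n≢0 b d}}
  ÷-+ a b@(suc _) c d@(suc _) = ℚP.toℚᵘ-injective
    (ℚᵘP.≃-trans (ℚP.toℚᵘ-homo-+ (a ÷ b) (c ÷ d)) (ℚᵘP.≃-trans (ℚᵘP.+-cong (toℚᵘ-÷ a b) (toℚᵘ-÷ c d))
      (ℚᵘP.≃-trans (*≡* (cong (ℤ._* + (b ℕ.* d)) numerator)) (ℚᵘP.≃-sym (toℚᵘ-÷ (a ℕ.* d ℕ.+ c ℕ.* b) (b ℕ.* d))))))
    where
    numerator : + a ℤ.* + d ℤ.+ + c ℤ.* + b ≡ + (a ℕ.* d ℕ.+ c ℕ.* b)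
    numerator = trans (cong₂ ℤ._+_ (sym (ℤP.pos-* a d)) (sym (ℤP.pos-* c b))) (sym (ℤP.pos-+ (a ℕ.* d) _))

  ÷-* : ∀ a b c d .{{_ : NonZero b}} .{{_ : NonZero d}} →
        (a ÷ b) * (c ÷ d) ≡ ((a ℕ.* c) ÷ (b ℕ.* d)) {{ℕP.m*n≢0 b d}}
  ÷-* a b@(suc _) c d@(suc _) = ℚP.toℚᵘ-injective
    (ℚᵘP.≃-trans (ℚP.toℚᵘ-homo-* (a ÷ b) (c ÷ d)) (ℚᵘP.≃-trans (ℚᵘP.*-cong (toℚᵘ-÷ a b) (toℚᵘ-÷ c d))
      (ℚᵘP.≃-trans (*≡* (cong (ℤ._* + (b ℕ.* d)) (sym (ℤP.pos-* a c)))) (ℚᵘP.≃-sym (toℚᵘ-÷ (a ℕ.* c) (b ℕ.* d))))))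

  0≤÷ : ∀ a b .{{_ : NonZero b}} → 0ℚ ≤ a ÷ b
  0≤÷ a b = ÷-mono-≤ 0 1 a b ℕ.z≤n

  toℚ-+ : ∀ m n → toℚ (m ℕ.+ n) ≡ toℚ m + toℚ n
  toℚ-+ m n = sym (trans (÷-+ m 1 n 1) (cong (_÷ 1) (cong₂ ℕ._+_ (ℕP.*-identityʳ m) (ℕP.*-identityʳ n))))

  toℚ-mono-≤ : ∀ {m n} → m ℕ.≤ n → toℚ m ≤ toℚ n
  toℚ-mono-≤ {m} {n} m≤n = ÷-mono-≤ m 1 n 1 (ℕP.*-monoˡ-≤ 1 m≤n)

  ÷-distribʳ-+ : ∀ a c d .{{_ : NonZero d}} → (a ℕ.+ c) ÷ d ≡ a ÷ d + c ÷ d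
  ÷-distribʳ-+ a c d@(suc _) = sym (trans (÷-+ a d c d) (÷-cong (a ℕ.* d ℕ.+ c ℕ.* d) (d ℕ.* d) (a ℕ.+ c) d (identity a c d)))
    where
    identity : ∀ a c d → (a ℕ.* d ℕ.+ c ℕ.* d) ℕ.* d ≡ (a ℕ.+ c) ℕ.* (d ℕ.* d)
    identity = solve-∀

  toℚ*÷ : ∀ a d .{{_ : NonZero d}} → toℚ a * (1 ÷ d) ≡ a ÷ d
  toℚ*÷ a d@(suc _) = trans (÷-* a 1 1 d) (÷-cong (a ℕ.* 1) (1 ℕ.* d) a d (identity a d))
    where
    identity : ∀ a d → a ℕ.* 1 ℕ.* d ≡ a ℕ.* (1 ℕ.* d)
    identity = solve-∀

  -q≤p≤q⇒∣p∣≤q : ∀ {p q} → - q ≤ p → p ≤ q → ∣ p ∣ ≤ q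
  -q≤p≤q⇒∣p∣≤q {p} {q} -q≤p p≤q with ℚP.∣p∣≡p∨∣p∣≡-p p
  ... | inj₁ ∣p∣≡p  = subst (_≤ q) (sym ∣p∣≡p) p≤q
  ... | inj₂ ∣p∣≡-p = subst₂ _≤_ (sym ∣p∣≡-p) (neg-involutive q) (ℚP.neg-antimono-≤ -q≤p)
    where
    neg-involutive : ∀ q → - (- q) ≡ q
    neg-involutive = solve 1 (λ q → :- (:- q) := q) refl

  ∣p-q∣≤r : ∀ {p q r} → 0ℚ ≤ p → p ≤ r → 0ℚ ≤ q → q ≤ r → ∣ p - q ∣ ≤ r
  ∣p-q∣≤r {p} {q} {r} 0≤p p≤r 0≤q q≤r = -q≤p≤q⇒∣p∣≤q
    (subst (_≤ p - q) (ℚP.+-identityˡ (- r)) (ℚP.+-mono-≤ 0≤p (ℚP.neg-antimono-≤ q≤r)))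
    (subst (p - q ≤_) (ℚP.+-identityʳ r) (ℚP.+-mono-≤ p≤r (ℚP.neg-antimono-≤ 0≤q)))

  p≤1⇒p*q≤q : ∀ {p q} → p ≤ 1ℚ → 0ℚ ≤ q → p * q ≤ q
  p≤1⇒p*q≤q {p} {q} p≤1 0≤q = subst (p * q ≤_) (ℚP.*-identityˡ q)
    (ℚP.*-monoʳ-≤-nonNeg q {{ℚ.nonNegative 0≤q}} p≤1)

  p≤q⇒0≤q-p : ∀ {p q} → p ≤ q → 0ℚ ≤ q - p
  p≤q⇒0≤q-p {p} {q} p≤q = subst (_≤ q - p) (ℚP.+-inverseʳ p) (ℚP.+-monoˡ-≤ (- p) p≤q)

  q≤p+r⇒q-p≤r : ∀ {p q r} → q ≤ p + r → q - p ≤ r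
  q≤p+r⇒q-p≤r {p} {q} {r} q≤p+r = subst (q - p ≤_) (cancel p r) (ℚP.+-monoˡ-≤ (- p) q≤p+r)
    where
    cancel : ∀ p r → p + r - p ≡ r
    cancel = solve 2 (λ p r → p :+ r :- p := r) refl

  nonNeg-*-≤ : ∀ {p q r} → 0ℚ ≤ p → q ≤ r → p * q ≤ p * r
  nonNeg-*-≤ {p} 0≤p = ℚP.*-monoˡ-≤-nonNeg p {{ℚ.nonNegative 0≤p}}

  0≤* : ∀ {p q} → 0ℚ ≤ p → 0ℚ ≤ q → 0ℚ ≤ p * q
  0≤* {p} {q} 0≤p 0≤q = subst (_≤ p * q) (ℚP.*-zeroʳ p) (nonNeg-*-≤ 0≤p 0≤q)


module RationalSums where

  open import Data.Rational as ℚ using (_+_; _-_; _≤_; 0ℚ; ∣_∣)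
  open import Relation.Binary.PropositionalEquality
  open import Data.Rational.Solver using (module +-*-Solver)
  open +-*-Solver using (solve; _:=_; _:+_; _:-_)
  open Fractions

  module ℕ∑ = Summation ℕP.+-*-commutativeSemiring
  open Summation (CommutativeRing.commutativeSemiring ℚP.+-*-commutativeRing) public

  ∑-mono-≤ : ∀ {f g} n → (∀ i → i ℕ.< n → f i ≤ g i) → ∑ f n ≤ ∑ g n
  ∑-mono-≤ zero    f≤g = ℚP.≤-refl
  ∑-mono-≤ (suc n) f≤g = ℚP.+-mono-≤ (f≤g 0 (s≤s z≤n)) (∑-mono-≤ n (λ i i<n → f≤g (suc i) (s≤s i<n)))

  ∑-nonNeg : ∀ {f} n → (∀ i → 0ℚ ≤ f i) → 0ℚ ≤ ∑ f n
  ∑-nonNeg n 0≤f = ℚP.≤-trans (ℚP.≤-reflexive (sym (∑-zero n))) (∑-mono-≤ n (λ i _ → 0≤f i))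

  ∑-distrib-- : ∀ f g n → ∑[ i < n ] (f i - g i) ≡ ∑ f n - ∑ g n
  ∑-distrib-- f g zero    = refl
  ∑-distrib-- f g (suc n) = trans (cong (f 0 - g 0 +_) (∑-distrib-- (f ∘ suc) (g ∘ suc) n))
                                  (interchange (f 0) (g 0) (∑ (f ∘ suc) n) (∑ (g ∘ suc) n))
    where
    interchange : ∀ a b c d → a - b + (c - d) ≡ a + c - (b + d)
    interchange = solve 4 (λ a b c d → a :- b :+ (c :- d) := a :+ c :- (b :+ d)) refl

  ∣∑∣≤∑∣∣ : ∀ f n → ∣ ∑ f n ∣ ≤ ∑[ i < n ] ∣ f i ∣
  ∣∑∣≤∑∣∣ f zero    = ℚP.≤-refl
  ∣∑∣≤∑∣∣ f (suc n) = ℚP.≤-trans (ℚP.∣p+q∣≤∣p∣+∣q∣ (f 0) _) (ℚP.+-monoʳ-≤ ∣ f 0 ∣ (∣∑∣≤∑∣∣ (f ∘ suc) n))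

  toℚ-∑ : ∀ f n → toℚ (ℕ∑.∑ f n) ≡ ∑[ i < n ] toℚ (f i)
  toℚ-∑ f zero    = refl
  toℚ-∑ f (suc n) = trans (toℚ-+ (f 0) _) (cong (toℚ (f 0) +_) (toℚ-∑ (f ∘ suc) n))


module GcdB where

  open import Data.Nat using (_*_; _≤_)
  open import Data.Nat.Properties
  open import Data.Nat.Divisibility
  open import Data.Nat.DivMod using (_/_; m/n*n≡m)
  open import Data.Nat.GCD using (gcd; gcd[m,n]∣m; gcd[m,n]∣n; gcd[m,n]≢0)
  open import Data.Nat.Coprimality as Coprime using (Coprime; coprime-divisor; coprime-/gcd)
  open import Data.Nat.Tactic.RingSolver using (solve-∀)
  open import Data.Product using (_×_; _,_; proj₁; proj₂)
  open import Data.Sum using (inj₁; inj₂)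
  open import Relation.Nullary using (¬_; yes; no; contradiction)
  open import Relation.Binary.PropositionalEquality

  BDivisor : ℕ → ℕ → ℕ → ℕ → Set
  BDivisor b r s k = k ∣ r × k ^ b ∣ s

  IsGcdB : ℕ → ℕ → ℕ → ℕ → Set
  IsGcdB b r s k = BDivisor b r s k × (∀ m → BDivisor b r s m → m ≤ k)

  1-bDivisor : ∀ b r s → BDivisor b r s 1
  1-bDivisor b r s = 1∣ r , subst (_∣ s) (sym (^-zeroˡ b)) (1∣ s)

  ≤-pred-excluding : ∀ {P : ℕ → Set} n → (∀ m → P m → m ≤ suc n) → ¬ P (suc n) → ∀ m → P m → m ≤ n
  ≤-pred-excluding n bounded ¬Pn+1 m Pm with m≤n⇒m<n∨m≡n (bounded m Pm)
  ... | inj₁ m<n+1 = ≤-pred m<n+1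
  ... | inj₂ refl  = contradiction Pm ¬Pn+1

  gcdSearch-isGcdB : ∀ b r s n → (∀ m → BDivisor b r s m → m ≤ n) → IsGcdB b r s (gcdSearch b r s n)
  gcdSearch-isGcdB b r s zero    bounded = contradiction (bounded 1 (1-bDivisor b r s)) λ ()
  gcdSearch-isGcdB b r s (suc n) bounded with suc n ∣? r | suc n ^ b ∣? s
  ... | yes n+1∣r | yes n+1^b∣s = (n+1∣r , n+1^b∣s) , bounded
  ... | yes _     | no  n+1^b∤s = gcdSearch-isGcdB b r s n (≤-pred-excluding n bounded (n+1^b∤s ∘ proj₂))
  ... | no  n+1∤r | _           = gcdSearch-isGcdB b r s n (≤-pred-excluding n bounded (n+1∤r ∘ proj₁))

  gcdB-isGcdB : ∀ b r s .{{_ : NonZero r}} → IsGcdB b r s (gcdB b r s)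
  gcdB-isGcdB b r@(suc _) s = gcdSearch-isGcdB b r s r (λ m m∣r → ∣⇒≤ (proj₁ m∣r))

  isGcdB-unique : ∀ {b r s k l} → IsGcdB b r s k → IsGcdB b r s l → k ≡ l
  isGcdB-unique (k-div , k-max) (l-div , l-max) = ≤-antisym (l-max _ k-div) (k-max _ l-div)

  isGcdB⇒gcdB≡ : ∀ {b r s k} .{{_ : NonZero r}} → IsGcdB b r s k → gcdB b r s ≡ k
  isGcdB⇒gcdB≡ {b} {r} {s} = isGcdB-unique {b} {r} {s} (gcdB-isGcdB b r s)

  ^-distribʳ-* : ∀ m n k → (m * n) ^ k ≡ m ^ k * n ^ k
  ^-distribʳ-* m n zero    = refl
  ^-distribʳ-* m n (suc k) = trans (cong (m * n *_) (^-distribʳ-* m n k)) (interchange m n (m ^ k) (n ^ k))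
    where
    interchange : ∀ a b c d → a * b * (c * d) ≡ a * c * (b * d)
    interchange = solve-∀

  coprime-^ʳ : ∀ {m n} k → Coprime m n → Coprime m (n ^ k)
  coprime-^ʳ zero    _          (_   , i∣1)      = ∣1⇒≡1 i∣1
  coprime-^ʳ (suc k) coprime[m,n] {i} (i∣m , i∣n*n^k) =
    coprime-^ʳ k coprime[m,n] (i∣m , coprime-divisor coprime[i,n] i∣n*n^k)
    where
    coprime[i,n] : Coprime i _
    coprime[i,n] (j∣i , j∣n) = coprime[m,n] (∣-trans j∣i i∣m , j∣n)

  coprime-^ : ∀ {m n} k → Coprime m n → Coprime (m ^ k) (n ^ k)
  coprime-^ k = Coprime.sym ∘ coprime-^ʳ k ∘ Coprime.sym ∘ coprime-^ʳ k

  bDivisor-scale : ∀ b d {r s m} → BDivisor b r s m → BDivisor b (d * r) (d ^ b * s) (d * m)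
  bDivisor-scale b d {m = m} (m∣r , m^b∣s) =
    *-monoʳ-∣ d m∣r , subst (_∣ _) (sym (^-distribʳ-* d m b)) (*-monoʳ-∣ (d ^ b) m^b∣s)

  gcd-nonZeroʳ : ∀ m n .{{_ : NonZero n}} → NonZero (gcd m n)
  gcd-nonZeroʳ m n = ℕ.≢-nonZero (gcd[m,n]≢0 m n (inj₂ (ℕ.≢-nonZero⁻¹ n)))

  bDivisor-/gcd : ∀ b d {r s m} .{{_ : NonZero d}} →
                  BDivisor b (d * r) (d ^ b * s) m → BDivisor b r s ((m / gcd m d) {{gcd-nonZeroʳ m d}})
  bDivisor-/gcd b d {r} {s} {m} (m∣dr , m^b∣d^bs) =
    coprime-divisor coprime[m′,d′] (*-cancelʳ-∣ g (subst₂ _∣_ m≡m′g dr≡d′rg m∣dr)) ,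
    coprime-divisor (coprime-^ b coprime[m′,d′]) (*-cancelʳ-∣ (g ^ b) (subst₂ _∣_ m^b≡m′^bg^b d^bs≡d′^bsg^b m^b∣d^bs))
    where
    g = gcd m d
    instance
      g≢0 : NonZero g
      g≢0 = gcd-nonZeroʳ m d
      g^b≢0 : NonZero (g ^ b)
      g^b≢0 = m^n≢0 g b
    m′ = m / g
    d′ = d / g
    coprime[m′,d′] : Coprime m′ d′
    coprime[m′,d′] = coprime-/gcd m d
    m≡m′g : m ≡ m′ * g
    m≡m′g = sym (m/n*n≡m (gcd[m,n]∣m m d))
    d≡d′g : d ≡ d′ * g
    d≡d′g = sym (m/n*n≡m (gcd[m,n]∣n m d))
    swap₂₃ : ∀ x y z → x * y * z ≡ x * z * y
    swap₂₃ = solve-∀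
    dr≡d′rg : d * r ≡ d′ * r * g
    dr≡d′rg = trans (cong (_* r) d≡d′g) (swap₂₃ d′ g r)
    m^b≡m′^bg^b : m ^ b ≡ m′ ^ b * g ^ b
    m^b≡m′^bg^b = trans (cong (_^ b) m≡m′g) (^-distribʳ-* m′ g b)
    d^bs≡d′^bsg^b : d ^ b * s ≡ d′ ^ b * s * g ^ b
    d^bs≡d′^bsg^b = trans (cong (λ x → x ^ b * s) d≡d′g)
                     (trans (cong (_* s) (^-distribʳ-* d′ g b)) (swap₂₃ (d′ ^ b) (g ^ b) s))

  isGcdB-unscale : ∀ b d r s .{{_ : NonZero d}} → IsGcdB b (d * r) (d ^ b * s) d → IsGcdB b r s 1
  isGcdB-unscale b d r s (_ , d-max) = 1-bDivisor b r s , λ m m-div →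
    *-cancelˡ-≤ d (subst (d * m ≤_) (sym (*-identityʳ d)) (d-max (d * m) (bDivisor-scale b d m-div)))

  isGcdB-scale : ∀ b d r s .{{_ : NonZero d}} → IsGcdB b r s 1 → IsGcdB b (d * r) (d ^ b * s) d
  isGcdB-scale b d r s (_ , 1-max) = (m∣m*n r , m∣m*n s) , d-max
    where
    d-max : ∀ m → BDivisor b (d * r) (d ^ b * s) m → m ≤ d
    d-max m m-div = begin
      m                     ≡⟨ m/n*n≡m (gcd[m,n]∣m m d) ⟨
      m / gcd m d * gcd m d ≤⟨ *-monoˡ-≤ (gcd m d) (1-max _ (bDivisor-/gcd b d m-div)) ⟩
      1 * gcd m d           ≡⟨ *-identityˡ (gcd m d) ⟩
      gcd m d               ≤⟨ ∣⇒≤ (gcd[m,n]∣n m d) ⟩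
      d                     ∎
      where
      open ≤-Reasoning
      instance _ = gcd-nonZeroʳ m d


module Counting where

  open import Data.Bool using (true; false; if_then_else_)
  open import Data.List using (List; []; _∷_; map; filter; length; applyUpTo; upTo)
  import Data.List.Properties as List
  open import Data.Nat using (_+_; _*_; _≤_; _<_; _≟_)
  open import Data.Nat.Properties
  open import Data.Nat.Divisibility
  open import Data.Nat.DivMod using (_/_; _%_; m≡m%n+[m/n]*n; m%n<n)
  open import Data.Nat.ListAction using (sum)
  open import Data.Product using (proj₁; proj₂)
  open import Function using (_∘_; _⇔_; mk⇔)
  open import Relation.Nullary using (¬_; Dec; does; contradiction)
  open import Relation.Nullary.Decidable using (dec-false; does-⇔)
  open import Relation.Binary.PropositionalEquality
  open Summation +-*-commutativeSemiring
  open GcdB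

  𝟙 : ∀ {P : Set} → Dec P → ℕ
  𝟙 P? = if does P? then 1 else 0

  𝟙-no : ∀ {P : Set} (P? : Dec P) → ¬ P → 𝟙 P? ≡ 0
  𝟙-no P? ¬p = cong (λ b → if b then 1 else 0) (dec-false P? ¬p)

  𝟙-cong : ∀ {P Q : Set} (P? : Dec P) (Q? : Dec Q) → P ⇔ Q → 𝟙 P? ≡ 𝟙 Q?
  𝟙-cong P? Q? P⇔Q = cong (λ b → if b then 1 else 0) (does-⇔ P⇔Q P? Q?)

  length-filter≡sum-𝟙 : ∀ {A : Set} {P : A → Set} (P? : ∀ x → Dec (P x)) xs →
                        length (filter P? xs) ≡ sum (map (𝟙 ∘ P?) xs)
  length-filter≡sum-𝟙 P? []       = refl
  length-filter≡sum-𝟙 P? (x ∷ xs) with does (P? x)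
  ... | true  = cong suc (length-filter≡sum-𝟙 P? xs)
  ... | false = length-filter≡sum-𝟙 P? xs

  sum-map-applyUpTo : ∀ (h f : ℕ → ℕ) n → sum (map h (applyUpTo f n)) ≡ ∑[ i < n ] h (f i)
  sum-map-applyUpTo h f zero    = refl
  sum-map-applyUpTo h f (suc n) = cong (h (f 0) +_) (sum-map-applyUpTo h (f ∘ suc) n)

  sum-map-range1 : ∀ (h : ℕ → ℕ) n → sum (map h (range1 n)) ≡ ∑[ i < n ] h (suc i)
  sum-map-range1 h n = trans (cong sum (sym (List.map-∘ (upTo n)))) (sum-map-applyUpTo (h ∘ suc) (λ i → i) n)

  pairCount : ℕ → ℕ → ℕ → ℕ → ℕ
  pairCount b k R S = ∑[ i < R ] ∑[ j < S ] 𝟙 (gcdB b (suc i) (suc j) ≟ k)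

  coprimeCount : ℕ → ℕ → ℕ → ℕ
  coprimeCount b = pairCount b 1

  count≡pairCount : ∀ b k N → count b k N ≡ pairCount b k N N
  count≡pairCount b k N = begin
    sum (map (λ r → length (filter (λ s → gcdB b r s ≟ k) (range1 N))) (range1 N))
      ≡⟨ cong sum (List.map-cong row≡ (range1 N)) ⟩
    sum (map (λ r → ∑[ j < N ] 𝟙 (gcdB b r (suc j) ≟ k)) (range1 N))
      ≡⟨ sum-map-range1 _ N ⟩
    pairCount b k N N ∎
    where
    open ≡-Reasoning
    row≡ : ∀ r → length (filter (λ s → gcdB b r s ≟ k) (range1 N)) ≡ ∑[ j < N ] 𝟙 (gcdB b r (suc j) ≟ k)
    row≡ r = trans (length-filter≡sum-𝟙 (λ s → gcdB b r s ≟ k) (range1 N)) (sum-map-range1 _ N)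

  ∑-multiples-quotient : ∀ d .{{_ : NonZero d}} (f : ℕ → ℕ) → (∀ r → ¬ d ∣ r → f r ≡ 0) →
                         ∀ q t → t < d → ∑[ i < q * d + t ] f (suc i) ≡ ∑[ i < q ] f (d * suc i)
  ∑-multiples-quotient d f f-vanishes zero t t<d =
    ∑-vanishing t (λ i i<t → f-vanishes (suc i) (>⇒∤ (≤-trans (s≤s i<t) t<d)))
  ∑-multiples-quotient d@(suc d-1) f f-vanishes (suc q) t t<d = begin
    ∑[ i < d + q * d + t ] f (suc i)
      ≡⟨ cong (λ n → ∑[ i < n ] f (suc i)) (+-assoc d (q * d) t) ⟩
    ∑[ i < d + (q * d + t) ] f (suc i)
      ≡⟨ ∑-split (f ∘ suc) d (q * d + t) ⟩
    ∑[ i < d ] f (suc i) + ∑[ i < q * d + t ] f (suc (d + i))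
      ≡⟨ cong₂ _+_ first-block (∑-cong (q * d + t) (λ i _ → cong f (sym (+-suc d i)))) ⟩
    f d + ∑[ i < q * d + t ] f (d + suc i)
      ≡⟨ cong₂ _+_ (cong f (sym (*-identityʳ d)))
                   (∑-multiples-quotient d (f ∘ (d +_)) shifted-vanishes q t t<d) ⟩
    f (d * 1) + ∑[ i < q ] f (d + d * suc i)
      ≡⟨ cong (f (d * 1) +_) (∑-cong q (λ i _ → cong f (sym (*-suc d (suc i))))) ⟩
    ∑[ i < suc q ] f (d * suc i) ∎
    where
    open ≡-Reasoning
    shifted-vanishes : ∀ r → ¬ d ∣ r → f (d + r) ≡ 0
    shifted-vanishes r d∤r = f-vanishes (d + r) (λ d∣d+r → d∤r (∣m+n∣m⇒∣n d∣d+r ∣-refl))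
    first-block : ∑[ i < d ] f (suc i) ≡ f d
    first-block = trans (∑-snoc (f ∘ suc) d-1) (cong (_+ f d)
      (∑-vanishing d-1 (λ i i<d-1 → f-vanishes (suc i) (>⇒∤ (s≤s i<d-1)))))

  ∑-multiples : ∀ d .{{_ : NonZero d}} (f : ℕ → ℕ) → (∀ r → ¬ d ∣ r → f r ≡ 0) →
                ∀ R → ∑[ i < R ] f (suc i) ≡ ∑[ i < R / d ] f (d * suc i)
  ∑-multiples d f f-vanishes R = trans
    (cong (λ n → ∑[ i < n ] f (suc i)) (trans (m≡m%n+[m/n]*n R d) (+-comm (R % d) _)))
    (∑-multiples-quotient d f f-vanishes (R / d) (R % d) (m%n<n R d))

  gcdB-scale : ∀ b d r s .{{_ : NonZero d}} .{{_ : NonZero r}} →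
               gcdB b (d * r) (d ^ b * s) ≡ d ⇔ gcdB b r s ≡ 1
  gcdB-scale b d r s = mk⇔
    (λ gcd≡d → isGcdB⇒gcdB≡ (isGcdB-unscale b d r s (subst (IsGcdB b _ _) gcd≡d (gcdB-isGcdB b (d * r) _))))
    (λ gcd≡1 → isGcdB⇒gcdB≡ (isGcdB-scale b d r s (subst (IsGcdB b r s) gcd≡1 (gcdB-isGcdB b r s))))
    where instance _ = m*n≢0 d r

  pairCount-scale : ∀ b d .{{_ : NonZero d}} R S →
                    pairCount b d R S ≡ coprimeCount b (R / d) ((S / d ^ b) {{m^n≢0 d b}})
  pairCount-scale b d R S =
    trans (∑-multiples d row d∤r⇒row≡0 R)
          (∑-cong (R / d) (λ i _ → trans (∑-multiples (d ^ b) (entry (d * suc i)) (d^b∤s⇒entry≡0 i) S)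
                                         (∑-cong (S / d ^ b) (λ j _ → entry≡ (suc i) (suc j)))))
    where
    instance _ = m^n≢0 d b
    entry : ℕ → ℕ → ℕ
    entry r s = 𝟙 (gcdB b r s ≟ d)
    row : ℕ → ℕ
    row r = ∑[ j < S ] entry r (suc j)
    d∤r⇒row≡0 : ∀ r → ¬ d ∣ r → row r ≡ 0
    d∤r⇒row≡0 zero      d∤0 = contradiction (d ∣0) d∤0
    d∤r⇒row≡0 r@(suc _) d∤r = ∑-vanishing S (λ j _ → 𝟙-no (gcdB b r (suc j) ≟ d)
      (λ gcd≡d → d∤r (subst (_∣ r) gcd≡d (proj₁ (proj₁ (gcdB-isGcdB b r (suc j)))))))
    d^b∤s⇒entry≡0 : ∀ i s → ¬ d ^ b ∣ s → entry (d * suc i) s ≡ 0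
    d^b∤s⇒entry≡0 i s d^b∤s = 𝟙-no (gcdB b (d * suc i) s ≟ d)
      (λ gcd≡d → d^b∤s (subst (λ k → k ^ b ∣ s) gcd≡d (proj₂ (proj₁ (gcdB-isGcdB b (d * suc i) s {{m*n≢0 d (suc i)}})))))
    entry≡ : ∀ r s .{{_ : NonZero r}} → entry (d * r) (d ^ b * s) ≡ 𝟙 (gcdB b r s ≟ 1)
    entry≡ r s = 𝟙-cong (gcdB b (d * r) (d ^ b * s) ≟ d) (gcdB b r s ≟ 1) (gcdB-scale b d r s)

  ∑-const : ∀ c n → ∑[ _ < n ] c ≡ n * c
  ∑-const c zero    = refl
  ∑-const c (suc n) = cong (c +_) (∑-const c n)

  ∑-𝟙-point : ∀ x R → 1 ≤ x → x ≤ R → ∑[ k < R ] 𝟙 (x ≟ suc k) ≡ 1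
  ∑-𝟙-point 1 (suc R) _ _ = cong suc (∑-vanishing R (λ k _ → 𝟙-no (1 ≟ suc (suc k)) λ ()))
  ∑-𝟙-point (suc x@(suc _)) (suc R) _ (s≤s x≤R) = begin
    𝟙 (suc x ≟ 1) + ∑[ k < R ] 𝟙 (suc x ≟ suc (suc k)) ≡⟨ cong₂ _+_ (𝟙-no (suc x ≟ 1) λ ()) (∑-cong R shift) ⟩
    0 + ∑[ k < R ] 𝟙 (x ≟ suc k)                       ≡⟨ ∑-𝟙-point x R (s≤s z≤n) x≤R ⟩
    1                                                   ∎
    where
    open ≡-Reasoning
    shift : ∀ k → k < R → 𝟙 (suc x ≟ suc (suc k)) ≡ 𝟙 (x ≟ suc k)
    shift k _ = 𝟙-cong (suc x ≟ suc (suc k)) (x ≟ suc k) (mk⇔ suc-injective (cong suc))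

  ∑-pairCount : ∀ b R S → ∑[ k < R ] pairCount b (suc k) R S ≡ R * S
  ∑-pairCount b R S = begin
    ∑[ k < R ] ∑[ i < R ] ∑[ j < S ] 𝟙 (g i j ≟ suc k)  ≡⟨ ∑-comm _ R R ⟩
    ∑[ i < R ] ∑[ k < R ] ∑[ j < S ] 𝟙 (g i j ≟ suc k)  ≡⟨ ∑-cong R (λ i _ → ∑-comm (λ k j → 𝟙 (g i j ≟ suc k)) R S) ⟩
    ∑[ i < R ] ∑[ j < S ] ∑[ k < R ] 𝟙 (g i j ≟ suc k)  ≡⟨ ∑-cong R (λ i i<R → ∑-cong S (λ j _ → column≡1 i j i<R)) ⟩
    ∑[ i < R ] ∑[ j < S ] 1                             ≡⟨ ∑-cong R (λ i _ → ∑-const 1 S) ⟩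
    ∑[ i < R ] (S * 1)                                  ≡⟨ ∑-const (S * 1) R ⟩
    R * (S * 1)                                         ≡⟨ cong (R *_) (*-identityʳ S) ⟩
    R * S                                               ∎
    where
    open ≡-Reasoning
    g : ℕ → ℕ → ℕ
    g i j = gcdB b (suc i) (suc j)
    column≡1 : ∀ i j → i < R → ∑[ k < R ] 𝟙 (g i j ≟ suc k) ≡ 1
    column≡1 i j i<R = ∑-𝟙-point (g i j) R (proj₂ g-isGcdB 1 (1-bDivisor b _ _)) (≤-trans (∣⇒≤ (proj₁ (proj₁ g-isGcdB))) i<R)
      where g-isGcdB = gcdB-isGcdB b (suc i) (suc j)

  coprimeCount≤ : ∀ b R S → coprimeCount b R S ≤ R * S
  coprimeCount≤ b zero    S = z≤n
  coprimeCount≤ b (suc R) S = subst (coprimeCount b (suc R) S ≤_) (∑-pairCount b (suc R) S) (m≤m+n _ _)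


module Zeta where

  open import Data.Nat.Tactic.RingSolver using (solve-∀)
  open import Data.Rational as ℚ using (ℚ; _+_; _≤_; 0ℚ; 1ℚ)
  open import Relation.Binary.PropositionalEquality
  open Fractions
  open RationalSums

  zetaTerm : ℕ → ℕ → ℚ
  zetaTerm b n = (1 ÷ suc n ^ suc b) {{ℕP.m^n≢0 (suc n) (suc b)}}

  0≤zetaTerm : ∀ b n → 0ℚ ≤ zetaTerm b n
  0≤zetaTerm b n = 0≤÷ 1 (suc n ^ suc b) {{ℕP.m^n≢0 (suc n) (suc b)}}

  zetaTerm-0 : ∀ b → zetaTerm b 0 ≡ 1ℚ
  zetaTerm-0 b = ÷-cong 1 (1 ^ suc b) 1 1 {{ℕP.m^n≢0 1 (suc b)}} (sym (trans (ℕP.*-identityˡ _) (ℕP.^-zeroˡ (suc b))))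

  zetaPartial≡∑ : ∀ b M → zetaPartial b M ≡ ∑[ n < suc M ] zetaTerm b n
  zetaPartial≡∑ b zero    = sym (trans (ℚP.+-identityʳ _) (zetaTerm-0 b))
  zetaPartial≡∑ b (suc M) = trans (cong (_+ zetaTerm b (suc M)) (zetaPartial≡∑ b M)) (sym (∑-snoc (zetaTerm b) (suc M)))

  zetaHead : ℕ → ℕ → ℚ
  zetaHead b D = ∑[ n < D ] zetaTerm b (suc n)

  zetaPartial-split : ∀ b D r →
    zetaPartial b (D ℕ.+ r) ≡ 1ℚ + zetaHead b D + ∑[ n < r ] zetaTerm b (suc (D ℕ.+ n))
  zetaPartial-split b D r = trans (zetaPartial≡∑ b (D ℕ.+ r))
    (trans (cong₂ _+_ (zetaTerm-0 b) (∑-split (zetaTerm b ∘ suc) D r)) (sym (ℚP.+-assoc 1ℚ (zetaHead b D) _)))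

  -- For b ≥ 1, (a+2)^-(b+1) ≤ 1/((a+1)(a+2)) = 1/(a+1) - 1/(a+2), so the tail of ζ telescopes.
  zetaTerm-telescope : ∀ b .{{_ : NonZero b}} a → zetaTerm b (suc a) + 1 ÷ suc (suc a) ≤ 1 ÷ suc a
  zetaTerm-telescope b a = begin
    1 ÷ P + 1 ÷ n+1                     ≡⟨ ÷-+ 1 P 1 n+1 ⟩
    (1 ℕ.* n+1 ℕ.+ 1 ℕ.* P) ÷ (P ℕ.* n+1) ≤⟨ ÷-mono-≤ (1 ℕ.* n+1 ℕ.+ 1 ℕ.* P) (P ℕ.* n+1) 1 n cross ⟩
    1 ÷ n                               ∎
    where
    open ℚP.≤-Reasoning
    n = suc a
    n+1 = suc n
    P = n+1 ^ suc b
    instance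
      _ = ℕP.m^n≢0 n+1 (suc b)
      _ = ℕP.m*n≢0 P n+1
    [n+1]n≤P : n+1 ℕ.* n ℕ.≤ P
    [n+1]n≤P = ℕP.≤-trans (ℕP.*-monoʳ-≤ n+1 (ℕP.≤-trans (ℕP.n≤1+n n) (ℕP.≤-reflexive (sym (ℕP.*-identityʳ n+1)))))
                          (ℕP.^-monoʳ-≤ n+1 (s≤s (ℕ.>-nonZero⁻¹ b)))
    lhs≡ : ∀ x P n → (1 ℕ.* x ℕ.+ 1 ℕ.* P) ℕ.* n ≡ x ℕ.* n ℕ.+ P ℕ.* n
    lhs≡ = solve-∀
    rhs≡ : ∀ P n → 1 ℕ.* (P ℕ.* suc n) ≡ P ℕ.+ P ℕ.* n
    rhs≡ = solve-∀
    cross : (1 ℕ.* n+1 ℕ.+ 1 ℕ.* P) ℕ.* n ℕ.≤ 1 ℕ.* (P ℕ.* n+1)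
    cross = subst₂ ℕ._≤_ (sym (lhs≡ n+1 P n)) (sym (rhs≡ P n)) (ℕP.+-monoˡ-≤ (P ℕ.* n) [n+1]n≤P)

  zetaTail-telescope : ∀ b .{{_ : NonZero b}} a m →
    ∑[ j < m ] zetaTerm b (suc (a ℕ.+ j)) + 1 ÷ suc (a ℕ.+ m) ≤ 1 ÷ suc a
  zetaTail-telescope b a zero    = ℚP.≤-reflexive
    (trans (ℚP.+-identityˡ _) (cong (λ x → 1 ÷ suc x) (ℕP.+-identityʳ a)))
  zetaTail-telescope b a (suc m) = begin
    zetaTerm b (suc (a ℕ.+ 0)) + ∑[ j < m ] zetaTerm b (suc (a ℕ.+ suc j)) + 1 ÷ suc (a ℕ.+ suc m)
      ≡⟨ cong₂ (λ x y → zetaTerm b (suc x) + y + 1 ÷ suc (a ℕ.+ suc m)) (ℕP.+-identityʳ a)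
               (∑-cong m (λ j _ → cong (zetaTerm b ∘ suc) (ℕP.+-suc a j))) ⟩
    zetaTerm b (suc a) + ∑[ j < m ] zetaTerm b (suc (suc a ℕ.+ j)) + 1 ÷ suc (a ℕ.+ suc m)
      ≡⟨ cong (λ x → zetaTerm b (suc a) + ∑[ j < m ] zetaTerm b (suc (suc a ℕ.+ j)) + 1 ÷ suc x) (ℕP.+-suc a m) ⟩
    zetaTerm b (suc a) + ∑[ j < m ] zetaTerm b (suc (suc a ℕ.+ j)) + 1 ÷ suc (suc a ℕ.+ m)
      ≡⟨ ℚP.+-assoc (zetaTerm b (suc a)) _ _ ⟩
    zetaTerm b (suc a) + (∑[ j < m ] zetaTerm b (suc (suc a ℕ.+ j)) + 1 ÷ suc (suc a ℕ.+ m))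
      ≤⟨ ℚP.+-monoʳ-≤ (zetaTerm b (suc a)) (zetaTail-telescope b (suc a) m) ⟩
    zetaTerm b (suc a) + 1 ÷ suc (suc a)
      ≤⟨ zetaTerm-telescope b a ⟩
    1 ÷ suc a ∎
    where open ℚP.≤-Reasoning

  zetaTail≤ : ∀ b .{{_ : NonZero b}} a m → ∑[ j < m ] zetaTerm b (suc (a ℕ.+ j)) ≤ 1 ÷ suc a
  zetaTail≤ b a m = begin
    tail                        ≡⟨ ℚP.+-identityʳ tail ⟨
    tail + 0ℚ                   ≤⟨ ℚP.+-monoʳ-≤ tail (0≤÷ 1 (suc (a ℕ.+ m))) ⟩
    tail + 1 ÷ suc (a ℕ.+ m)    ≤⟨ zetaTail-telescope b a m ⟩
    1 ÷ suc a                   ∎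
    where
    open ℚP.≤-Reasoning
    tail = ∑[ j < m ] zetaTerm b (suc (a ℕ.+ j))

  zetaHead≤ : ∀ b .{{_ : NonZero b}} D → zetaHead b D ≤ 3 ÷ 4
  zetaHead≤ b zero    = 0≤÷ 3 4
  zetaHead≤ b (suc D) = begin
    zetaTerm b 1 + ∑[ n < D ] zetaTerm b (suc (1 ℕ.+ n)) ≤⟨ ℚP.+-mono-≤ 2^-[b+1]≤1/4 (zetaTail≤ b 1 D) ⟩
    1 ÷ 4 + 1 ÷ 2                                       ≡⟨ ÷-+ 1 4 1 2 ⟩
    6 ÷ 8                                               ≡⟨ ÷-cong 6 8 3 4 refl ⟩
    3 ÷ 4                                               ∎
    where
    open ℚP.≤-Reasoning
    2^-[b+1]≤1/4 : zetaTerm b 1 ≤ 1 ÷ 4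
    2^-[b+1]≤1/4 = ÷-mono-≤ 1 (2 ^ suc b) 1 4 {{ℕP.m^n≢0 2 (suc b)}}
      (ℕP.*-monoʳ-≤ 1 (ℕP.^-monoʳ-≤ 2 (s≤s (ℕ.>-nonZero⁻¹ b))))


module Areas where

  open import Data.Nat using (_+_; _*_; _≤_)
  open import Data.Nat.Properties
  open import Data.Nat.DivMod using (_/_; _%_; m≡m%n+[m/n]*n; m%n<n; m/n*n≤m; m/n≤m; /-monoˡ-≤; m*n/n≡m)
  open import Data.Nat.Tactic.RingSolver using (solve-∀)
  open import Relation.Binary.PropositionalEquality

  m*n≤o⇒m≤o/n : ∀ m n o .{{_ : NonZero n}} → m * n ≤ o → m ≤ o / n
  m*n≤o⇒m≤o/n m n o m*n≤o = subst (_≤ o / n) (m*n/n≡m m n) (/-monoˡ-≤ n m*n≤o)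

  m≤[m/n+1]*n : ∀ m n .{{_ : NonZero n}} → m ≤ (m / n + 1) * n
  m≤[m/n+1]*n m n = begin
    m                   ≡⟨ m≡m%n+[m/n]*n m n ⟩
    m % n + m / n * n   ≤⟨ +-monoˡ-≤ (m / n * n) (<⇒≤ (m%n<n m n)) ⟩
    n + m / n * n       ≡⟨ identity (m / n) n ⟩
    (m / n + 1) * n     ∎
    where
    open ≤-Reasoning
    identity : ∀ q n → n + q * n ≡ (q + 1) * n
    identity = solve-∀

  [m/d]*[n/e]*[d*e]≤m*n : ∀ m n d e .{{_ : NonZero d}} .{{_ : NonZero e}} → m / d * (n / e) * (d * e) ≤ m * n
  [m/d]*[n/e]*[d*e]≤m*n m n d e = begin
    m / d * (n / e) * (d * e)   ≡⟨ interchange (m / d) (n / e) d e ⟩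
    (m / d * d) * (n / e * e)   ≤⟨ *-mono-≤ (m/n*n≤m m d) (m/n*n≤m n e) ⟩
    m * n                       ∎
    where
    open ≤-Reasoning
    interchange : ∀ a b c d → a * b * (c * d) ≡ (a * c) * (b * d)
    interchange = solve-∀

  m*n≤[d*e]*[[m/d]*[n/e]+m+n+1] : ∀ m n d e .{{_ : NonZero d}} .{{_ : NonZero e}} →
                                  m * n ≤ d * e * (m / d * (n / e) + (m + n + 1))
  m*n≤[d*e]*[[m/d]*[n/e]+m+n+1] m n d e = begin
    m * n                                            ≤⟨ *-mono-≤ (m≤[m/n+1]*n m d) (m≤[m/n+1]*n n e) ⟩
    (m / d + 1) * d * ((n / e + 1) * e)              ≡⟨ expand (m / d) (n / e) d e ⟩
    d * e * (m / d * (n / e) + (m / d + n / e + 1))  ≤⟨ *-monoʳ-≤ (d * e) (+-monoʳ-≤ (m / d * (n / e))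
                                                          (+-monoˡ-≤ 1 (+-mono-≤ (m/n≤m m d) (m/n≤m n e)))) ⟩
    d * e * (m / d * (n / e) + (m + n + 1))          ∎
    where
    open ≤-Reasoning
    expand : ∀ p q d e → (p + 1) * d * ((q + 1) * e) ≡ d * e * (p * q + (p + q + 1))
    expand = solve-∀

  K[m+n+1]≤mn : ∀ K m n .{{_ : NonZero K}} → 3 * K ≤ m → 3 * K ≤ n → K * (m + n + 1) ≤ m * n
  K[m+n+1]≤mn K m n 3K≤m 3K≤n = *-cancelˡ-≤ 3 (begin
    3 * (K * (m + n + 1))            ≡⟨ expand K m n ⟩
    3 * K * m + 3 * K * n + 3 * K    ≤⟨ +-mono-≤ (+-mono-≤ (*-monoˡ-≤ m 3K≤n) (*-monoˡ-≤ n 3K≤m)) 3K≤mn ⟩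
    n * m + m * n + m * n            ≡⟨ collect m n ⟩
    3 * (m * n)                      ∎)
    where
    open ≤-Reasoning
    expand : ∀ K m n → 3 * (K * (m + n + 1)) ≡ 3 * K * m + 3 * K * n + 3 * K
    expand = solve-∀
    collect : ∀ m n → n * m + m * n + m * n ≡ 3 * (m * n)
    collect = solve-∀
    1≤n : 1 ≤ n
    1≤n = ≤-trans (ℕ.>-nonZero⁻¹ K) (≤-trans (m≤n*m K 3) 3K≤n)
    3K≤mn : 3 * K ≤ m * n
    3K≤mn = ≤-trans 3K≤m (≤-trans (≤-reflexive (sym (*-identityʳ m))) (*-monoʳ-≤ m 1≤n))


module Estimates where

  open import Data.Rational as ℚ using (ℚ; _+_; _*_; _-_; _≤_; 0ℚ; 1ℚ; ∣_∣)
  open import Relation.Binary.PropositionalEquality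
  open import Data.Rational.Solver using (module +-*-Solver)
  open +-*-Solver using (solve; _:=_; _:+_; _:*_; _:-_; con)
  open Fractions

  -- With X = C + A + T and c (1 + s + z) = 1, the error C - c X splits into the error of the
  -- approximation s X ≈ P, the error A - c P of the lower levels, and the discarded tail.
  error-decomposition : ∀ {X C A T P s c z} → X ≡ C + A + T → c * (1ℚ + s + z) ≡ 1ℚ →
    C - c * X ≡ c * (s * X - P) - (A - c * P) + (c * z * X - T)
  error-decomposition {X} {C} {A} {T} {P} {s} {c} {z} X≡C+A+T c[1+s+z]≡1 = begin
    C - c * X                                                   ≡⟨ cong (λ Y → C - c * Y) X≡C+A+T ⟩
    C - c * (C + A + T)                                         ≡⟨ identity C A T P s c z ⟩
    split (C + A + T) + (C + A + T) * (1ℚ - c * (1ℚ + s + z))   ≡⟨ cong (λ K → split (C + A + T) + (C + A + T) * (1ℚ - K)) c[1+s+z]≡1 ⟩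
    split (C + A + T) + (C + A + T) * (1ℚ - 1ℚ)                 ≡⟨ drop-zero (split (C + A + T)) (C + A + T) ⟩
    split (C + A + T)                                           ≡⟨ cong split (sym X≡C+A+T) ⟩
    split X                                                     ∎
    where
    open ≡-Reasoning
    split : ℚ → ℚ
    split Y = c * (s * Y - P) - (A - c * P) + (c * z * Y - T)
    identity : ∀ C A T P s c z → C - c * (C + A + T) ≡
      c * (s * (C + A + T) - P) - (A - c * P) + (c * z * (C + A + T) - T) + (C + A + T) * (1ℚ - c * (1ℚ + s + z))
    identity = solve 7 (λ C A T P s c z →
      C :- c :* (C :+ A :+ T) :=
      c :* (s :* (C :+ A :+ T) :- P) :- (A :- c :* P) :+ (c :* z :* (C :+ A :+ T) :- T)
        :+ (C :+ A :+ T) :* (con 1ℚ :- c :* (con 1ℚ :+ s :+ z))) refl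
    drop-zero : ∀ x y → x + y * (1ℚ - 1ℚ) ≡ x
    drop-zero = solve 2 (λ x y → x :+ y :* (con 1ℚ :- con 1ℚ) := x) refl

  contraction : ∀ {X C A T P E s c z δ i q} →
    X ≡ C + A + T → c * (1ℚ + s + z) ≡ 1ℚ → 0ℚ ≤ c → c ≤ 1ℚ → 0ℚ ≤ z → z ≤ i → 0ℚ ≤ X →
    ∣ A - c * P ∣ ≤ δ * P → 0ℚ ≤ δ → s ≤ q →
    P ≤ s * X → s * X ≤ P + E → E ≤ i * X → 0ℚ ≤ T → T ≤ i * X →
    ∣ C - c * X ∣ ≤ (q * δ + (i + i)) * X
  contraction {X} {C} {A} {T} {P} {E} {s} {c} {z} {δ} {i} {q}
              X≡C+A+T c[1+s+z]≡1 0≤c c≤1 0≤z z≤i 0≤X ∣A-cP∣≤δP 0≤δ s≤q P≤sX sX≤P+E E≤iX 0≤T T≤iX = begin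
    ∣ C - c * X ∣                                          ≡⟨ cong ∣_∣ (error-decomposition {X} {C} {A} {T} {P} {s} {c} {z} X≡C+A+T c[1+s+z]≡1) ⟩
    ∣ c * (s * X - P) - (A - c * P) + (c * z * X - T) ∣    ≤⟨ triangle (c * (s * X - P)) (A - c * P) (c * z * X - T) ⟩
    ∣ c * (s * X - P) ∣ + ∣ A - c * P ∣ + ∣ c * z * X - T ∣ ≤⟨ ℚP.+-mono-≤ (ℚP.+-mono-≤ approximation-error lower-levels) tail ⟩
    i * X + q * δ * X + i * X                              ≡⟨ regroup i (q * δ) X ⟩
    (q * δ + (i + i)) * X                                  ∎
    where
    open ℚP.≤-Reasoning
    triangle : ∀ u v w → ∣ u - v + w ∣ ≤ ∣ u ∣ + ∣ v ∣ + ∣ w ∣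
    triangle u v w = ℚP.≤-trans (ℚP.∣p+q∣≤∣p∣+∣q∣ (u - v) w) (ℚP.+-monoˡ-≤ ∣ w ∣ (ℚP.∣p-q∣≤∣p∣+∣q∣ u v))
    regroup : ∀ i r X → i * X + r * X + i * X ≡ (r + (i + i)) * X
    regroup = solve 3 (λ i r X → i :* X :+ r :* X :+ i :* X := (r :+ (i :+ i)) :* X) refl
    approximation-error : ∣ c * (s * X - P) ∣ ≤ i * X
    approximation-error = subst (_≤ i * X) (sym (ℚP.0≤p⇒∣p∣≡p (0≤* 0≤c (p≤q⇒0≤q-p P≤sX))))
      (ℚP.≤-trans (p≤1⇒p*q≤q c≤1 (p≤q⇒0≤q-p P≤sX)) (ℚP.≤-trans (q≤p+r⇒q-p≤r sX≤P+E) E≤iX))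
    lower-levels : ∣ A - c * P ∣ ≤ q * δ * X
    lower-levels = begin
      ∣ A - c * P ∣ ≤⟨ ∣A-cP∣≤δP ⟩
      δ * P         ≤⟨ nonNeg-*-≤ 0≤δ (ℚP.≤-trans P≤sX (ℚP.*-monoʳ-≤-nonNeg X {{ℚ.nonNegative 0≤X}} s≤q)) ⟩
      δ * (q * X)   ≡⟨ reassociate δ q X ⟩
      q * δ * X     ∎
      where
      reassociate : ∀ δ q X → δ * (q * X) ≡ q * δ * X
      reassociate = solve 3 (λ δ q X → δ :* (q :* X) := q :* δ :* X) refl
    czX≤iX : c * z * X ≤ i * X
    czX≤iX = ℚP.≤-trans (ℚP.≤-reflexive (ℚP.*-assoc c z X))
               (ℚP.≤-trans (p≤1⇒p*q≤q c≤1 (0≤* 0≤z 0≤X)) (ℚP.*-monoʳ-≤-nonNeg X {{ℚ.nonNegative 0≤X}} z≤i))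
    tail : ∣ c * z * X - T ∣ ≤ i * X
    tail = ∣p-q∣≤r (0≤* (0≤* 0≤c 0≤z) 0≤X) czX≤iX 0≤T T≤iX

  density-error : ∀ {C X U V c δ ε} → 0ℚ ≤ c → c ≤ 1ℚ → 0ℚ ≤ δ → 0ℚ ≤ U →
    ∣ C - c * X ∣ ≤ δ * X → X * U ≤ 1ℚ → X * U ≤ V → V ≤ X * U + ε →
    ∣ C * U - c * V ∣ ≤ δ + ε
  density-error {C} {X} {U} {V} {c} {δ} {ε} 0≤c c≤1 0≤δ 0≤U ∣C-cX∣≤δX XU≤1 XU≤V V≤XU+ε = begin
    ∣ C * U - c * V ∣                           ≡⟨ cong ∣_∣ (identity C X U V c) ⟩
    ∣ (C - c * X) * U - c * (V - X * U) ∣       ≤⟨ ℚP.∣p-q∣≤∣p∣+∣q∣ ((C - c * X) * U) (c * (V - X * U)) ⟩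
    ∣ (C - c * X) * U ∣ + ∣ c * (V - X * U) ∣   ≤⟨ ℚP.+-mono-≤ scaled-error boundary-error ⟩
    δ + ε                                       ∎
    where
    open ℚP.≤-Reasoning
    identity : ∀ C X U V c → C * U - c * V ≡ (C - c * X) * U - c * (V - X * U)
    identity = solve 5 (λ C X U V c → C :* U :- c :* V := (C :- c :* X) :* U :- c :* (V :- X :* U)) refl
    0≤V-XU : 0ℚ ≤ V - X * U
    0≤V-XU = p≤q⇒0≤q-p XU≤V
    scaled-error : ∣ (C - c * X) * U ∣ ≤ δ
    scaled-error = begin
      ∣ (C - c * X) * U ∣   ≡⟨ trans (ℚP.∣p*q∣≡∣p∣*∣q∣ (C - c * X) U) (cong (∣ C - c * X ∣ *_) (ℚP.0≤p⇒∣p∣≡p 0≤U)) ⟩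
      ∣ C - c * X ∣ * U     ≤⟨ ℚP.*-monoʳ-≤-nonNeg U {{ℚ.nonNegative 0≤U}} ∣C-cX∣≤δX ⟩
      δ * X * U             ≡⟨ ℚP.*-assoc δ X U ⟩
      δ * (X * U)           ≤⟨ nonNeg-*-≤ 0≤δ XU≤1 ⟩
      δ * 1ℚ                ≡⟨ ℚP.*-identityʳ δ ⟩
      δ                     ∎
    boundary-error : ∣ c * (V - X * U) ∣ ≤ ε
    boundary-error = begin
      ∣ c * (V - X * U) ∣   ≡⟨ ℚP.0≤p⇒∣p∣≡p (0≤* 0≤c 0≤V-XU) ⟩
      c * (V - X * U)       ≤⟨ p≤1⇒p*q≤q c≤1 0≤V-XU ⟩
      V - X * U             ≤⟨ q≤p+r⇒q-p≤r V≤XU+ε ⟩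
      ε                     ∎


module Bootstrap where

  open import Data.Nat.DivMod using (_/_)
  open import Data.Nat.Tactic.RingSolver using (solve-∀)
  open import Data.Rational as ℚ using (ℚ; _+_; _*_; _-_; _≤_; 0ℚ; 1ℚ; ∣_∣)
  open import Data.Product using (_×_; _,_; proj₁; proj₂)
  open import Relation.Binary.PropositionalEquality
  open import Data.Rational.Solver using (module +-*-Solver)
  open +-*-Solver using (solve; _:=_; _:+_; _:*_)
  open Fractions
  open RationalSums
  open Counting using (pairCount; coprimeCount; pairCount-scale; ∑-pairCount; coprimeCount≤; ∑-const)
  open Zeta
  open Areas
  open Estimates using (contraction)

  -- Indices are shifted by one: e stands for the scale d = e + 1, matching zetaTerm b e = d^-(b+1).
  scaledArea : ℕ → ℕ → ℕ → ℕ → ℕ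
  scaledArea b R S e = R / suc e ℕ.* (S / suc e ^ b) {{ℕP.m^n≢0 (suc e) b}}

  pairCount≤scaledArea : ∀ b R S e → pairCount b (suc e) R S ℕ.≤ scaledArea b R S e
  pairCount≤scaledArea b R S e = subst (ℕ._≤ scaledArea b R S e) (sym (pairCount-scale b (suc e) R S))
    (coprimeCount≤ b (R / suc e) ((S / suc e ^ b) {{ℕP.m^n≢0 (suc e) b}}))

  zetaTerm*toℚ : ∀ b e n → zetaTerm b e * toℚ n ≡ (n ÷ suc e ^ suc b) {{ℕP.m^n≢0 (suc e) (suc b)}}
  zetaTerm*toℚ b e n = trans (ℚP.*-comm (zetaTerm b e) (toℚ n)) (toℚ*÷ n (suc e ^ suc b) {{ℕP.m^n≢0 (suc e) (suc b)}})

  scaledArea≤ : ∀ b R S e → toℚ (scaledArea b R S e) ≤ zetaTerm b e * toℚ (R ℕ.* S)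
  scaledArea≤ b R S e = subst (toℚ (scaledArea b R S e) ≤_) (sym (zetaTerm*toℚ b e (R ℕ.* S)))
    (÷-mono-≤ (scaledArea b R S e) 1 (R ℕ.* S) (suc e ^ suc b)
      (ℕP.≤-trans ([m/d]*[n/e]*[d*e]≤m*n R S (suc e) (suc e ^ b)) (ℕP.≤-reflexive (sym (ℕP.*-identityʳ _)))))
    where instance _ = ℕP.m^n≢0 (suc e) b
                   _ = ℕP.m^n≢0 (suc e) (suc b)

  scaledArea≥ : ∀ b R S e → zetaTerm b e * toℚ (R ℕ.* S) ≤ toℚ (scaledArea b R S e) + toℚ (R ℕ.+ S ℕ.+ 1)
  scaledArea≥ b R S e = subst₂ _≤_ (sym (zetaTerm*toℚ b e (R ℕ.* S))) (toℚ-+ (scaledArea b R S e) _)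
    (÷-mono-≤ (R ℕ.* S) (suc e ^ suc b) (scaledArea b R S e ℕ.+ (R ℕ.+ S ℕ.+ 1)) 1
      (subst₂ ℕ._≤_ (sym (ℕP.*-identityʳ (R ℕ.* S))) (ℕP.*-comm (suc e ^ suc b) _)
        (m*n≤[d*e]*[[m/d]*[n/e]+m+n+1] R S (suc e) (suc e ^ b))))
    where instance _ = ℕP.m^n≢0 (suc e) b
                   _ = ℕP.m^n≢0 (suc e) (suc b)

  CoprimeCountApprox : ℕ → ℚ → ℕ → ℚ → Set
  CoprimeCountApprox b c T δ = ∀ R S → T ℕ.≤ R → T ℕ.≤ S →
    ∣ toℚ (coprimeCount b R S) - c * toℚ (R ℕ.* S) ∣ ≤ δ * toℚ (R ℕ.* S)

  approx-base : ∀ b {c} → 0ℚ ≤ c → c ≤ 1ℚ → CoprimeCountApprox b c 0 1ℚ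
  approx-base b {c} 0≤c c≤1 R S _ _ = subst (∣ toℚ (coprimeCount b R S) - c * X ∣ ≤_) (sym (ℚP.*-identityˡ X))
    (∣p-q∣≤r (0≤÷ (coprimeCount b R S) 1) (toℚ-mono-≤ (coprimeCount≤ b R S))
             (0≤* 0≤c (0≤÷ (R ℕ.* S) 1)) (p≤1⇒p*q≤q c≤1 (0≤÷ (R ℕ.* S) 1)))
    where X = toℚ (R ℕ.* S)

  approx-weaken : ∀ {b c T δ δ′} → δ ≤ δ′ → CoprimeCountApprox b c T δ → CoprimeCountApprox b c T δ′
  approx-weaken δ≤δ′ approx R S T≤R T≤S =
    ℚP.≤-trans (approx R S T≤R T≤S) (ℚP.*-monoʳ-≤-nonNeg _ {{ℚ.nonNegative (0≤÷ (R ℕ.* S) 1)}} δ≤δ′)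

  toℚ[R*S]-partition : ∀ b R S D₀ r → R ≡ suc (D₀ ℕ.+ r) →
    toℚ (R ℕ.* S) ≡ toℚ (coprimeCount b R S) + ∑[ e < D₀ ] toℚ (pairCount b (2 ℕ.+ e) R S)
                                              + ∑[ j < r ] toℚ (pairCount b (2 ℕ.+ (D₀ ℕ.+ j)) R S)
  toℚ[R*S]-partition b R S D₀ r R≡1+D₀+r = begin
    toℚ (R ℕ.* S)                                                ≡⟨ cong toℚ (sym (∑-pairCount b R S)) ⟩
    toℚ (ℕ∑.∑ (λ k → pairCount b (suc k) R S) R)                 ≡⟨ toℚ-∑ (λ k → pairCount b (suc k) R S) R ⟩
    ∑[ k < R ] f k                                                ≡⟨ cong (∑ f) R≡1+D₀+r ⟩
    f 0 + ∑[ k < D₀ ℕ.+ r ] f (suc k)                             ≡⟨ cong (f 0 +_) (∑-split (f ∘ suc) D₀ r) ⟩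
    f 0 + (∑[ e < D₀ ] f (suc e) + ∑[ j < r ] f (suc (D₀ ℕ.+ j))) ≡⟨ ℚP.+-assoc (f 0) _ _ ⟨
    f 0 + ∑[ e < D₀ ] f (suc e) + ∑[ j < r ] f (suc (D₀ ℕ.+ j))   ∎
    where
    open ≡-Reasoning
    f : ℕ → ℚ
    f k = toℚ (pairCount b (suc k) R S)

  scaledLevels-error : ∀ b R S n {c T δ} → CoprimeCountApprox b c T δ →
    (∀ e → e ℕ.< n → T ℕ.≤ R / (2 ℕ.+ e) × T ℕ.≤ (S / (2 ℕ.+ e) ^ b) {{ℕP.m^n≢0 (2 ℕ.+ e) b}}) →
    ∣ ∑[ e < n ] toℚ (pairCount b (2 ℕ.+ e) R S) - c * ∑[ e < n ] toℚ (scaledArea b R S (suc e)) ∣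
      ≤ δ * ∑[ e < n ] toℚ (scaledArea b R S (suc e))
  scaledLevels-error b R S n {c} {T} {δ} approx large = begin
    ∣ ∑ pairs n - c * ∑ area n ∣                    ≡⟨ cong (λ x → ∣ ∑ pairs n - x ∣) (∑-distribˡ-* c area n) ⟨
    ∣ ∑ pairs n - ∑[ e < n ] (c * area e) ∣         ≡⟨ cong ∣_∣ (∑-distrib-- pairs (λ e → c * area e) n) ⟨
    ∣ ∑[ e < n ] (pairs e - c * area e) ∣           ≤⟨ ∣∑∣≤∑∣∣ (λ e → pairs e - c * area e) n ⟩
    ∑[ e < n ] ∣ pairs e - c * area e ∣             ≤⟨ ∑-mono-≤ n level-error ⟩
    ∑[ e < n ] (δ * area e)                         ≡⟨ ∑-distribˡ-* δ area n ⟩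
    δ * ∑ area n                                    ∎
    where
    open ℚP.≤-Reasoning
    pairs area : ℕ → ℚ
    pairs e = toℚ (pairCount b (2 ℕ.+ e) R S)
    area e = toℚ (scaledArea b R S (suc e))
    level-error : ∀ e → e ℕ.< n → ∣ pairs e - c * area e ∣ ≤ δ * area e
    level-error e e<n = subst (λ x → ∣ toℚ x - c * area e ∣ ≤ δ * area e) (sym (pairCount-scale b (2 ℕ.+ e) R S))
      (approx (R / (2 ℕ.+ e)) _ (proj₁ (large e e<n)) (proj₂ (large e e<n)))

  scaledAreas≤ : ∀ b R S D₀ → ∑[ e < D₀ ] toℚ (scaledArea b R S (suc e)) ≤ zetaHead b D₀ * toℚ (R ℕ.* S)
  scaledAreas≤ b R S D₀ = ℚP.≤-trans (∑-mono-≤ D₀ (λ e _ → scaledArea≤ b R S (suc e)))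
                                     (ℚP.≤-reflexive (∑-distribʳ-* (toℚ (R ℕ.* S)) (zetaTerm b ∘ suc) D₀))

  scaledAreas≥ : ∀ b R S D₀ →
    zetaHead b D₀ * toℚ (R ℕ.* S) ≤ ∑[ e < D₀ ] toℚ (scaledArea b R S (suc e)) + toℚ (D₀ ℕ.* (R ℕ.+ S ℕ.+ 1))
  scaledAreas≥ b R S D₀ = begin
    zetaHead b D₀ * X                                        ≡⟨ ∑-distribʳ-* X (zetaTerm b ∘ suc) D₀ ⟨
    ∑[ e < D₀ ] (zetaTerm b (suc e) * X)                     ≤⟨ ∑-mono-≤ D₀ (λ e _ → scaledArea≥ b R S (suc e)) ⟩
    ∑[ e < D₀ ] (toℚ (scaledArea b R S (suc e)) + toℚ B)     ≡⟨ ∑-distrib-+ (λ e → toℚ (scaledArea b R S (suc e))) (λ _ → toℚ B) D₀ ⟩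
    ∑[ e < D₀ ] toℚ (scaledArea b R S (suc e)) + ∑[ _ < D₀ ] toℚ B
                                                             ≡⟨ cong (∑[ e < D₀ ] toℚ (scaledArea b R S (suc e)) +_) (trans (sym (toℚ-∑ (λ _ → B) D₀)) (cong toℚ (∑-const B D₀))) ⟩
    ∑[ e < D₀ ] toℚ (scaledArea b R S (suc e)) + toℚ (D₀ ℕ.* B) ∎
    where
    open ℚP.≤-Reasoning
    X = toℚ (R ℕ.* S)
    B = R ℕ.+ S ℕ.+ 1

  roundingError≤ : ∀ D₀ R S → 3 ℕ.* (suc D₀ ℕ.* suc D₀) ℕ.≤ R → 3 ℕ.* (suc D₀ ℕ.* suc D₀) ℕ.≤ S →
              toℚ (D₀ ℕ.* (R ℕ.+ S ℕ.+ 1)) ≤ 1 ÷ suc D₀ * toℚ (R ℕ.* S)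
  roundingError≤ D₀ R S 3D²≤R 3D²≤S = subst (toℚ (D₀ ℕ.* B) ≤_) (sym (trans (ℚP.*-comm (1 ÷ D) _) (toℚ*÷ (R ℕ.* S) D)))
    (÷-mono-≤ (D₀ ℕ.* B) 1 (R ℕ.* S) D (begin
      D₀ ℕ.* B ℕ.* D     ≡⟨ swap₂₃ D₀ B D ⟩
      D₀ ℕ.* D ℕ.* B     ≤⟨ ℕP.*-monoˡ-≤ B (ℕP.*-monoˡ-≤ D (ℕP.n≤1+n D₀)) ⟩
      D ℕ.* D ℕ.* B      ≤⟨ K[m+n+1]≤mn (D ℕ.* D) R S 3D²≤R 3D²≤S ⟩
      R ℕ.* S            ≡⟨ ℕP.*-identityʳ (R ℕ.* S) ⟨
      R ℕ.* S ℕ.* 1      ∎))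
    where
    open ℕP.≤-Reasoning
    D = suc D₀
    B = R ℕ.+ S ℕ.+ 1
    swap₂₃ : ∀ a b c → a ℕ.* b ℕ.* c ≡ a ℕ.* c ℕ.* b
    swap₂₃ = solve-∀

  largeScalesCount≤ : ∀ b .{{_ : NonZero b}} R S D₀ r →
    ∑[ j < r ] toℚ (pairCount b (2 ℕ.+ (D₀ ℕ.+ j)) R S) ≤ 1 ÷ suc D₀ * toℚ (R ℕ.* S)
  largeScalesCount≤ b R S D₀ r = begin
    ∑[ j < r ] toℚ (pairCount b (2 ℕ.+ (D₀ ℕ.+ j)) R S) ≤⟨ ∑-mono-≤ r (λ j _ → pairs≤ (suc (D₀ ℕ.+ j))) ⟩
    ∑[ j < r ] (zetaTerm b (suc (D₀ ℕ.+ j)) * X)       ≡⟨ ∑-distribʳ-* X (λ j → zetaTerm b (suc (D₀ ℕ.+ j))) r ⟩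
    ∑[ j < r ] zetaTerm b (suc (D₀ ℕ.+ j)) * X         ≤⟨ ℚP.*-monoʳ-≤-nonNeg X {{ℚ.nonNegative (0≤÷ (R ℕ.* S) 1)}} (zetaTail≤ b D₀ r) ⟩
    1 ÷ suc D₀ * X                                     ∎
    where
    open ℚP.≤-Reasoning
    X = toℚ (R ℕ.* S)
    pairs≤ : ∀ e → toℚ (pairCount b (suc e) R S) ≤ zetaTerm b e * X
    pairs≤ e = ℚP.≤-trans (toℚ-mono-≤ (pairCount≤scaledArea b R S e)) (scaledArea≤ b R S e)

  record ZetaReciprocal (b D₀ : ℕ) (c : ℚ) : Set where
    field
      tail       : ℚ
      0≤c        : 0ℚ ≤ c
      c≤1        : c ≤ 1ℚ
      0≤tail     : 0ℚ ≤ tail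
      tail≤1/D   : tail ≤ 1 ÷ suc D₀
      reciprocal : c * (1ℚ + zetaHead b D₀ + tail) ≡ 1ℚ

  -- T D^(b+1) keeps every rescaled box R/d × S/d^b with d ≤ D above the threshold T, and
  -- 3 D² makes the rounding error D₀ (R + S + 1) of the boxes at most RS/D.
  nextThreshold : ℕ → ℕ → ℕ → ℕ
  nextThreshold b D₀ T = T ℕ.* suc D₀ ^ suc b ℕ.+ 3 ℕ.* (suc D₀ ℕ.* suc D₀)

  approx-step : ∀ b .{{_ : NonZero b}} D₀ {c} → ZetaReciprocal b D₀ c → ∀ {T δ} → 0ℚ ≤ δ →
    CoprimeCountApprox b c T δ →
    CoprimeCountApprox b c (nextThreshold b D₀ T) (3 ÷ 4 * δ + (1 ÷ suc D₀ + 1 ÷ suc D₀))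
  approx-step b D₀ {c} zr {T} {δ} 0≤δ approx R S T′≤R T′≤S =
    contraction {C = toℚ (coprimeCount b R S)} {A = ∑[ e < D₀ ] toℚ (pairCount b (2 ℕ.+ e) R S)}
      (toℚ[R*S]-partition b R S D₀ (R ∸ D) (sym (ℕP.m+[n∸m]≡n D≤R)))
      reciprocal 0≤c c≤1 0≤tail tail≤1/D (0≤÷ (R ℕ.* S) 1)
      (scaledLevels-error b R S D₀ {c} {T} {δ} approx large) 0≤δ (zetaHead≤ b D₀)
      (scaledAreas≤ b R S D₀) (scaledAreas≥ b R S D₀) (roundingError≤ D₀ R S 3D²≤R 3D²≤S)
      (∑-nonNeg (R ∸ D) (λ j → 0≤÷ (pairCount b (2 ℕ.+ (D₀ ℕ.+ j)) R S) 1)) (largeScalesCount≤ b R S D₀ (R ∸ D))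
    where
    open ZetaReciprocal zr
    D = suc D₀
    instance _ = ℕP.m^n≢0 D b
    TD^[b+1]≤R : T ℕ.* D ^ suc b ℕ.≤ R
    TD^[b+1]≤R = ℕP.≤-trans (ℕP.m≤m+n _ _) T′≤R
    TD^[b+1]≤S : T ℕ.* D ^ suc b ℕ.≤ S
    TD^[b+1]≤S = ℕP.≤-trans (ℕP.m≤m+n _ _) T′≤S
    3D²≤R : 3 ℕ.* (D ℕ.* D) ℕ.≤ R
    3D²≤R = ℕP.≤-trans (ℕP.m≤n+m _ _) T′≤R
    3D²≤S : 3 ℕ.* (D ℕ.* D) ℕ.≤ S
    3D²≤S = ℕP.≤-trans (ℕP.m≤n+m _ _) T′≤S
    D≤R : D ℕ.≤ R
    D≤R = ℕP.≤-trans (ℕP.m≤m*n D D) (ℕP.≤-trans (ℕP.m≤n*m (D ℕ.* D) 3) 3D²≤R)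
    large : ∀ e → e ℕ.< D₀ → T ℕ.≤ R / (2 ℕ.+ e) × T ℕ.≤ (S / (2 ℕ.+ e) ^ b) {{ℕP.m^n≢0 (2 ℕ.+ e) b}}
    large e e<D₀ =
      m*n≤o⇒m≤o/n T (2 ℕ.+ e) R (ℕP.≤-trans (ℕP.*-monoʳ-≤ T (ℕP.≤-trans (s≤s e<D₀) (ℕP.m≤m*n D (D ^ b)))) TD^[b+1]≤R) ,
      m*n≤o⇒m≤o/n T ((2 ℕ.+ e) ^ b) S {{ℕP.m^n≢0 (2 ℕ.+ e) b}}
        (ℕP.≤-trans (ℕP.*-monoʳ-≤ T (ℕP.≤-trans (ℕP.^-monoˡ-≤ b (s≤s e<D₀)) (ℕP.m≤n*m (D ^ b) D))) TD^[b+1]≤S)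

  ¾^_ : ℕ → ℚ
  ¾^ zero  = 1ℚ
  ¾^ suc n = 3 ÷ 4 * ¾^ n

  0≤¾^ : ∀ n → 0ℚ ≤ ¾^ n
  0≤¾^ zero    = 0≤÷ 1 1
  0≤¾^ (suc n) = 0≤* (0≤÷ 3 4) (0≤¾^ n)

  ¾^n≤3/[3+n] : ∀ n → ¾^ n ≤ 3 ÷ (3 ℕ.+ n)
  ¾^n≤3/[3+n] zero    = ÷-mono-≤ 1 1 3 3 (ℕP.≤-refl {3})
  ¾^n≤3/[3+n] (suc n) = begin
    3 ÷ 4 * ¾^ n                ≤⟨ nonNeg-*-≤ (0≤÷ 3 4) (¾^n≤3/[3+n] n) ⟩
    3 ÷ 4 * (3 ÷ (3 ℕ.+ n))     ≡⟨ ÷-* 3 4 3 (3 ℕ.+ n) ⟩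
    9 ÷ (4 ℕ.* (3 ℕ.+ n))       ≤⟨ ÷-mono-≤ 9 (4 ℕ.* (3 ℕ.+ n)) 3 (4 ℕ.+ n) cross ⟩
    3 ÷ (4 ℕ.+ n)               ∎
    where
    open ℚP.≤-Reasoning
    expandˡ : ∀ n → 9 ℕ.* (4 ℕ.+ n) ≡ 36 ℕ.+ 9 ℕ.* n
    expandˡ = solve-∀
    expandʳ : ∀ n → 3 ℕ.* (4 ℕ.* (3 ℕ.+ n)) ≡ 36 ℕ.+ 12 ℕ.* n
    expandʳ = solve-∀
    cross : 9 ℕ.* (4 ℕ.+ n) ℕ.≤ 3 ℕ.* (4 ℕ.* (3 ℕ.+ n))
    cross = subst₂ ℕ._≤_ (sym (expandˡ n)) (sym (expandʳ n)) (ℕP.+-monoʳ-≤ 36 (ℕP.*-monoˡ-≤ n (ℕP.m≤m+n 9 3)))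

  threshold : ℕ → ℕ → ℕ → ℕ
  threshold b D₀ zero    = 0
  threshold b D₀ (suc n) = nextThreshold b D₀ (threshold b D₀ n)

  approx-iterate : ∀ b .{{_ : NonZero b}} D₀ {c} → ZetaReciprocal b D₀ c →
                   ∀ n → CoprimeCountApprox b c (threshold b D₀ n) (¾^ n + 8 ÷ suc D₀)
  approx-iterate b D₀ {c} zr zero    = approx-weaken {b} {c} 1≤1+8/D (approx-base b 0≤c c≤1)
    where
    open ZetaReciprocal zr
    1≤1+8/D : 1ℚ ≤ 1ℚ + 8 ÷ suc D₀
    1≤1+8/D = subst (_≤ 1ℚ + 8 ÷ suc D₀) (ℚP.+-identityʳ 1ℚ) (ℚP.+-monoʳ-≤ 1ℚ (0≤÷ 8 (suc D₀)))
  approx-iterate b D₀ {c} zr (suc n) = subst (CoprimeCountApprox b c (threshold b D₀ (suc n))) δ′≡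
    (approx-step b D₀ zr (ℚP.+-mono-≤ (0≤¾^ n) (0≤÷ 8 D)) (approx-iterate b D₀ zr n))
    where
    D = suc D₀
    regroup : ∀ q p e i → q * (p + e) + (i + i) ≡ q * p + (q * e + i + i)
    regroup = solve 4 (λ q p e i → q :* (p :+ e) :+ (i :+ i) := q :* p :+ (q :* e :+ i :+ i)) refl
    δ′≡ : 3 ÷ 4 * (¾^ n + 8 ÷ D) + (1 ÷ D + 1 ÷ D) ≡ ¾^ suc n + 8 ÷ D
    δ′≡ = begin
      3 ÷ 4 * (¾^ n + 8 ÷ D) + (1 ÷ D + 1 ÷ D)      ≡⟨ regroup (3 ÷ 4) (¾^ n) (8 ÷ D) (1 ÷ D) ⟩
      ¾^ suc n + (3 ÷ 4 * (8 ÷ D) + 1 ÷ D + 1 ÷ D)  ≡⟨ cong (λ x → ¾^ suc n + (x + 1 ÷ D + 1 ÷ D)) (÷-* 3 4 8 D) ⟩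
      ¾^ suc n + (24 ÷ (4 ℕ.* D) + 1 ÷ D + 1 ÷ D)   ≡⟨ cong (λ x → ¾^ suc n + (x + 1 ÷ D + 1 ÷ D)) (÷-cong 24 (4 ℕ.* D) 6 D (quarter D)) ⟩
      ¾^ suc n + (6 ÷ D + 1 ÷ D + 1 ÷ D)            ≡⟨ cong (λ x → ¾^ suc n + (x + 1 ÷ D)) (÷-distribʳ-+ 6 1 D) ⟨
      ¾^ suc n + (7 ÷ D + 1 ÷ D)                    ≡⟨ cong (¾^ suc n +_) (÷-distribʳ-+ 7 1 D) ⟨
      ¾^ suc n + 8 ÷ D                              ∎
      where
      open ≡-Reasoning
      quarter : ∀ D → 24 ℕ.* D ≡ 6 ℕ.* (4 ℕ.* D)
      quarter = solve-∀


module Convergence where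

  open import Data.Integer using (+[1+_])
  open import Data.Nat.DivMod using (_/_)
  open import Data.Nat.Tactic.RingSolver using (solve-∀)
  open import Data.Product using (_,_; ∃-syntax)
  open import Data.Rational as ℚ using (ℚ; mkℚ; _+_; _*_; _-_; _≤_; _<_; 0ℚ; 1ℚ; 1/_; ∣_∣; Positive)
  open import Relation.Binary.PropositionalEquality
  open Fractions
  open RationalSums
  open Counting using (coprimeCount; count≡pairCount; pairCount-scale)
  open Zeta
  open Areas using (m*n≤o⇒m≤o/n; [m/d]*[n/e]*[d*e]≤m*n; m*n≤[d*e]*[[m/d]*[n/e]+m+n+1])
  open Estimates using (density-error)
  open Bootstrap

  zetaReciprocal : ∀ b .{{_ : NonZero b}} D₀ M → D₀ ℕ.≤ M →
    ZetaReciprocal b D₀ ((1/ zetaPartial b M) {{ℚP.pos⇒nonZero (zetaPartial b M) {{zetaPartial-pos b M}}}})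
  zetaReciprocal b D₀ M D₀≤M = record
    { tail       = tail
    ; 0≤c        = 0≤c
    ; c≤1        = subst₂ _≤_ (ℚP.*-identityʳ c) (ℚP.*-inverseˡ Z) (nonNeg-*-≤ 0≤c 1≤Z)
    ; 0≤tail     = ∑-nonNeg (M ∸ D₀) (λ j → 0≤zetaTerm b (suc (D₀ ℕ.+ j)))
    ; tail≤1/D   = zetaTail≤ b D₀ (M ∸ D₀)
    ; reciprocal = trans (cong (c *_) (sym Z≡1+head+tail)) (ℚP.*-inverseˡ Z)
    }
    where
    instance
      _ = zetaPartial-pos b M
      _ = ℚP.pos⇒nonZero (zetaPartial b M)
    Z = zetaPartial b M
    c = 1/ Z
    tail = ∑[ j < M ∸ D₀ ] zetaTerm b (suc (D₀ ℕ.+ j))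
    Z≡1+head+tail : Z ≡ 1ℚ + zetaHead b D₀ + tail
    Z≡1+head+tail = trans (cong (zetaPartial b) (sym (ℕP.m+[n∸m]≡n D₀≤M))) (zetaPartial-split b D₀ (M ∸ D₀))
    0≤c : 0ℚ ≤ c
    0≤c = ℚP.<⇒≤ (ℚP.positive⁻¹ c {{ℚP.1/pos⇒pos Z}})
    1≤Z : 1ℚ ≤ Z
    1≤Z = begin
      1ℚ                           ≡⟨ trans (ℚP.+-identityʳ 1ℚ) (ℚP.+-identityʳ (1ℚ + 0ℚ)) ⟨
      1ℚ + 0ℚ + 0ℚ                 ≤⟨ ℚP.+-mono-≤ (ℚP.+-monoʳ-≤ 1ℚ (∑-nonNeg D₀ (λ e → 0≤zetaTerm b (suc e)))) (∑-nonNeg (M ∸ D₀) (λ j → 0≤zetaTerm b (suc (D₀ ℕ.+ j)))) ⟩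
      1ℚ + zetaHead b D₀ + tail    ≡⟨ Z≡1+head+tail ⟨
      Z                            ∎
      where open ℚP.≤-Reasoning

  small-unit-fraction : ∀ ε .{{_ : Positive ε}} → ∃[ m ] 1 ÷ suc m ≤ ε
  small-unit-fraction ε@(mkℚ +[1+ p ] d _) = d ,
    subst (1 ÷ suc d ≤_) (ℚP.↥p/↧p≡p ε) (÷-mono-≤ 1 (suc d) (suc p) (suc d) (ℕP.*-monoˡ-≤ (suc d) {1} {suc p} (s≤s z≤n)))

  module NormalisedBox (b k N : ℕ) .{{_ : NonZero k}} .{{_ : NonZero N}} where

    instance
      k^b≢0 : NonZero (k ^ b)
      k^b≢0 = ℕP.m^n≢0 k b
      k^[b+1]≢0 : NonZero (k ^ suc b)
      k^[b+1]≢0 = ℕP.m^n≢0 k (suc b)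
      N²≢0 : NonZero (N ℕ.* N)
      N²≢0 = ℕP.m*n≢0 N N

    R S : ℕ
    R = N / k
    S = N / k ^ b

    X U V : ℚ
    X = toℚ (R ℕ.* S)
    U = 1 ÷ (N ℕ.* N)
    V = 1 ÷ k ^ suc b

    XU≡ : X * U ≡ (R ℕ.* S) ÷ (N ℕ.* N)
    XU≡ = toℚ*÷ (R ℕ.* S) (N ℕ.* N)

    V≤1 : V ≤ 1ℚ
    V≤1 = ÷-mono-≤ 1 (k ^ suc b) 1 1 (ℕP.*-monoʳ-≤ 1 (ℕP.m^n>0 k (suc b)))

    XU≤V : X * U ≤ V
    XU≤V = subst (_≤ V) (sym XU≡) (÷-mono-≤ (R ℕ.* S) (N ℕ.* N) 1 (k ^ suc b)
      (ℕP.≤-trans ([m/d]*[n/e]*[d*e]≤m*n N N k (k ^ b)) (ℕP.≤-reflexive (sym (ℕP.*-identityˡ _)))))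

    V≤XU+3/N : V ≤ X * U + 3 ÷ N
    V≤XU+3/N = begin
      1 ÷ k ^ suc b                                        ≤⟨ ÷-mono-≤ 1 (k ^ suc b) (R ℕ.* S ℕ.+ B) (N ℕ.* N) cover ⟩
      (R ℕ.* S ℕ.+ B) ÷ (N ℕ.* N)                          ≡⟨ ÷-distribʳ-+ (R ℕ.* S) B (N ℕ.* N) ⟩
      (R ℕ.* S) ÷ (N ℕ.* N) + B ÷ (N ℕ.* N)                ≤⟨ ℚP.+-mono-≤ (ℚP.≤-reflexive (sym XU≡)) (÷-mono-≤ B (N ℕ.* N) 3 N B*N≤3N²) ⟩
      X * U + 3 ÷ N                                        ∎
      where
      open ℚP.≤-Reasoning
      B = N ℕ.+ N ℕ.+ 1
      cover : 1 ℕ.* (N ℕ.* N) ℕ.≤ (R ℕ.* S ℕ.+ B) ℕ.* k ^ suc b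
      cover = subst₂ ℕ._≤_ (sym (ℕP.*-identityˡ _)) (ℕP.*-comm (k ^ suc b) _)
        (m*n≤[d*e]*[[m/d]*[n/e]+m+n+1] N N k (k ^ b))
      expand : ∀ N → (N ℕ.+ N ℕ.+ N) ℕ.* N ≡ 3 ℕ.* (N ℕ.* N)
      expand = solve-∀
      B*N≤3N² : B ℕ.* N ℕ.≤ 3 ℕ.* (N ℕ.* N)
      B*N≤3N² = ℕP.≤-trans (ℕP.*-monoˡ-≤ N (ℕP.+-monoʳ-≤ (N ℕ.+ N) (ℕ.>-nonZero⁻¹ N))) (ℕP.≤-reflexive (expand N))

  density≈target : ∀ b k .{{_ : NonZero b}} .{{_ : NonZero k}} D₀ n N M .{{_ : NonZero N}} →
    threshold b D₀ n ℕ.* (k ℕ.* k ^ b) ℕ.≤ N → D₀ ℕ.≤ M →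
    ∣ density b k N - target b k M ∣ ≤ ¾^ n + 8 ÷ suc D₀ + 3 ÷ N
  density≈target b k D₀ n N M T[k*k^b]≤N D₀≤M =
    subst (λ x → ∣ x - target b k M ∣ ≤ _) density≡
      (density-error {C = toℚ (coprimeCount b R S)} {X = X} 0≤c c≤1 (ℚP.+-mono-≤ (0≤¾^ n) (0≤÷ 8 (suc D₀)))
         (0≤÷ 1 (N ℕ.* N)) (approx-iterate b D₀ zr n R S T≤R T≤S) (ℚP.≤-trans XU≤V V≤1) XU≤V V≤XU+3/N)
    where
    open NormalisedBox b k N
    zr = zetaReciprocal b D₀ M D₀≤M
    open ZetaReciprocal zr using (0≤c; c≤1)
    T = threshold b D₀ n
    T≤R : T ℕ.≤ R
    T≤R = m*n≤o⇒m≤o/n T k N (ℕP.≤-trans (ℕP.*-monoʳ-≤ T (ℕP.m≤m*n k (k ^ b))) T[k*k^b]≤N)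
    T≤S : T ℕ.≤ S
    T≤S = m*n≤o⇒m≤o/n T (k ^ b) N (ℕP.≤-trans (ℕP.*-monoʳ-≤ T (ℕP.m≤n*m (k ^ b) k)) T[k*k^b]≤N)
    density≡ : toℚ (coprimeCount b R S) * U ≡ density b k N
    density≡ = trans (toℚ*÷ (coprimeCount b R S) (N ℕ.* N))
      (cong (_÷ (N ℕ.* N)) (sym (trans (count≡pairCount b k N) (pairCount-scale b k N N))))

  -- With D₀ = 32 (m+1) and n = 12 (m+1), each of the three terms is at most 1 / (4 (m+1)).
  error-bound : ∀ m N .{{_ : NonZero N}} → 12 ℕ.* suc m ℕ.≤ N →
    ¾^ (12 ℕ.* suc m) + 8 ÷ suc (32 ℕ.* suc m) + 3 ÷ N < 1 ÷ suc m
  error-bound m N 12[1+m]≤N = begin-strict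
    ¾^ (12 ℕ.* m′) + 8 ÷ suc (32 ℕ.* m′) + 3 ÷ N
      ≤⟨ ℚP.+-mono-≤ (ℚP.+-mono-≤ (ℚP.≤-trans (¾^n≤3/[3+n] (12 ℕ.* m′)) (÷-mono-≤ 3 _ 1 q geometric))
                                  (÷-mono-≤ 8 _ 1 q cutoff))
                     (÷-mono-≤ 3 N 1 q boundary) ⟩
    1 ÷ q + 1 ÷ q + 1 ÷ q     ≡⟨ cong (_+ 1 ÷ q) (÷-distribʳ-+ 1 1 q) ⟨
    2 ÷ q + 1 ÷ q             ≡⟨ ÷-distribʳ-+ 2 1 q ⟨
    3 ÷ q                     <⟨ ÷-mono-< 3 q 1 m′ (subst (3 ℕ.* m′ ℕ.<_) (sym (ℕP.*-identityˡ q)) (ℕP.*-monoˡ-< m′ {3} {4} ℕP.≤-refl)) ⟩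
    1 ÷ m′                    ∎
    where
    open ℚP.≤-Reasoning
    m′ = suc m
    q = 4 ℕ.* m′
    12m′≡3q : ∀ m → 12 ℕ.* m ≡ 3 ℕ.* (4 ℕ.* m)
    12m′≡3q = solve-∀
    32m′≡8q : ∀ m → 32 ℕ.* m ≡ 8 ℕ.* (4 ℕ.* m)
    32m′≡8q = solve-∀
    geometric : 3 ℕ.* q ℕ.≤ 1 ℕ.* (3 ℕ.+ 12 ℕ.* m′)
    geometric = subst₂ ℕ._≤_ (12m′≡3q m′) (sym (ℕP.*-identityˡ _)) (ℕP.m≤n+m (12 ℕ.* m′) 3)
    cutoff : 8 ℕ.* q ℕ.≤ 1 ℕ.* suc (32 ℕ.* m′)
    cutoff = subst₂ ℕ._≤_ (32m′≡8q m′) (sym (ℕP.*-identityˡ _)) (ℕP.n≤1+n (32 ℕ.* m′))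
    boundary : 3 ℕ.* q ℕ.≤ 1 ℕ.* N
    boundary = subst₂ ℕ._≤_ (12m′≡3q m′) (sym (ℕP.*-identityˡ N)) 12[1+m]≤N

open import Data.Nat using (_≤_)
open import Data.Product using (_,_; ∃-syntax)
open import Data.Rational using (ℚ; Positive; ∣_∣; _-_; _<_)
open Bootstrap using (threshold)
open Convergence

mainTheorem2 : (b k : ℕ) → .{{_ : NonZero b}} → .{{_ : NonZero k}} →
    (ε : ℚ) → .{{_ : Positive ε}} →
    ∃[ N₀ ] ∃[ M₀ ] ((N M : ℕ) → .{{_ : NonZero N}} → N₀ ≤ N → M₀ ≤ M →
      ∣ density b k N - target b k M ∣ < ε)
mainTheorem2 b k ε =
  let m , 1/[1+m]≤ε = small-unit-fraction ε
      D₀ = 32 ℕ.* suc m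
      n  = 12 ℕ.* suc m
      T  = threshold b D₀ n ℕ.* (k ℕ.* k ^ b)
  in T ℕ.+ n , D₀ , λ N M N₀≤N D₀≤M →
       ℚP.≤-<-trans (density≈target b k D₀ n N M (ℕP.≤-trans (ℕP.m≤m+n T n) N₀≤N) D₀≤M)
                    (ℚP.<-≤-trans (error-bound m N (ℕP.≤-trans (ℕP.m≤n+m n T) N₀≤N)) 1/[1+m]≤ε)
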